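{- Let $G$ be a 3-connected cubic graph with a nontrivial barrier $S$. Then: (i) for any nontrivial component $K$ of $G-S$, $\partial(V(K))$ is a tight 3-cut and is a matching; (ii) for any nontrivial component $K$ of $G-S$, each $\partial(V(K))$-contraction is a 3-connected simple cubic graph; (iii) if $G$ is non-bipartite, then $G-S$ has a nontrivial non-bipartite component.
   Context: All graphs are finite, simple and connected unless they arise as contractions. For a graph with a perfect matching, a barrier is a set $S\subseteq V(G)$ with $o(G-S)=|S|$ ($o$ = number of odd components); it is nontrivial if $|S|\ge 2$. A component is nontrivial if it has at least two vertices. For $\emptyset\ne X\subsetneq V(G)$, $\partial(X)$ is the set of edges with exactly one end in $X$; a $k$-cut is an edge cut with $k$ edges. $G/X$ denotes the (possibly multi)graph obtained by contracting $X$ to a single vertex; the two $\partial(X)$-contractions are $G/X$ and $G/\overline{X}$, $\overline X=V(G)\setminus X$. A graph is matching covered if it is connected with at least two vertices and each edge lies in a perfect matching (2-connected cubic graphs are matching covered); an edge cut $C$ of a matching covered graph is tight if $|C\cap M|=1$ for every perfect matching $M$. -}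

module Defs where

open import Data.Nat using (ℕ; zero; suc; _+_; _*_; _≤_; _<_)
open import Data.Bool using (Bool; true; false; if_then_else_; _∧_; not; _xor_)
open import Data.Fin using (Fin; zero; suc)
open import Data.Fin.Subset using (Subset; _∈_; _∉_; _⊆_; _─_; ∣_∣; Nonempty)
open import Data.Vec using (lookup; _∷_)
open import Data.Product using (Σ; ∃; _×_; _,_; proj₁)
open import Relation.Binary.PropositionalEquality using (_≡_; _≢_)
open import Relation.Binary.Construct.Closure.ReflexiveTransitive using (Star)
open import Relation.Nullary using (¬_)

∑ : ∀ {n} → (Fin n → ℕ) → ℕ
∑ {zero}  f = 0
∑ {suc n} f = f zero + ∑ (λ i → f (suc i))

Odd : ℕ → Set
Odd k = ∃ λ j → k ≡ suc (2 * j)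

-- A (multi)graph whose vertex set is a subset V of Fin n;
-- m u v = number of edges joining u and v.
record MGraph (n : ℕ) : Set where
  constructor mgraph
  field
    V : Subset n
    m : Fin n → Fin n → ℕ
open MGraph public

IsMultigraph : ∀ {n} → MGraph n → Set
IsMultigraph G =
  (∀ u v → m G u v ≡ m G v u) ×
  (∀ v → m G v v ≡ 0) ×
  (∀ u v → 0 < m G u v → u ∈ V G × v ∈ V G)

Simple : ∀ {n} → MGraph n → Set
Simple G = IsMultigraph G × (∀ u v → m G u v ≤ 1)

Adj : ∀ {n} → MGraph n → Fin n → Fin n → Set
Adj G u v = 0 < m G u v

deg : ∀ {n} → MGraph n → Fin n → ℕ
deg G v = ∑ (λ u → m G v u)

Cubic : ∀ {n} → MGraph n → Set
Cubic G = ∀ v → v ∈ V G → deg G v ≡ 3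

StepIn : ∀ {n} → MGraph n → Subset n → Fin n → Fin n → Set
StepIn G W u v = u ∈ W × v ∈ W × Adj G u v

ConnectedSet : ∀ {n} → MGraph n → Subset n → Set
ConnectedSet G W = ∀ u v → u ∈ W → v ∈ W → Star (StepIn G W) u v

-- the induced subgraph G[W] is connected (connected graphs are nonempty)
ConnectedOn : ∀ {n} → MGraph n → Subset n → Set
ConnectedOn G W = Nonempty W × ConnectedSet G W

Connected : ∀ {n} → MGraph n → Set
Connected G = ConnectedOn G (V G)

KConnected : ∀ {n} → ℕ → MGraph n → Set
KConnected k G =
  k < ∣ V G ∣ × (∀ X → X ⊆ V G → ∣ X ∣ < k → ConnectedOn G (V G ─ X))

BipartiteOn : ∀ {n} → MGraph n → Subset n → Set
BipartiteOn {n} G W =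
  Σ (Fin n → Bool) λ c → ∀ u v → u ∈ W → v ∈ W → Adj G u v → c u ≢ c v

Bipartite : ∀ {n} → MGraph n → Set
Bipartite G = BipartiteOn G (V G)

IsComponent : ∀ {n} → MGraph n → Subset n → Subset n → Set
IsComponent G S K =
  K ⊆ (V G ─ S) × Nonempty K × ConnectedSet G K ×
  (∀ u v → u ∈ K → v ∈ V G → v ∉ S → Adj G u v → v ∈ K)

HasOddComponents : ∀ {n} → MGraph n → Subset n → ℕ → Set
HasOddComponents {n} G S k =
  Σ (Fin k → Subset n) λ K →
    (∀ i → IsComponent G S (K i) × Odd ∣ K i ∣) ×
    (∀ i j → K i ≡ K j → i ≡ j) ×
    (∀ L → IsComponent G S L → Odd ∣ L ∣ → ∃ λ i → K i ≡ L)

Barrier : ∀ {n} → MGraph n → Subset n → Set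
Barrier G S = S ⊆ V G × HasOddComponents G S ∣ S ∣

_∈ᵇ_ : ∀ {n} → Fin n → Subset n → Bool
v ∈ᵇ X = lookup X v

cutSize : ∀ {n} → MGraph n → Subset n → ℕ
cutSize G X = ∑ (λ u → ∑ (λ v →
  if (u ∈ᵇ X) ∧ not (v ∈ᵇ X) then m G u v else 0))

cutDeg : ∀ {n} → MGraph n → Subset n → Fin n → ℕ
cutDeg G X v = ∑ (λ u → if (v ∈ᵇ X) xor (u ∈ᵇ X) then m G v u else 0)

CutIsMatching : ∀ {n} → MGraph n → Subset n → Set
CutIsMatching G X = ∀ v → cutDeg G X v ≤ 1

-- a perfect matching of a simple graph, as the partner map v ↦ M(v)
PerfectMatching : ∀ {n} → MGraph n → Set
PerfectMatching {n} G =
  Σ (Fin n → Fin n) λ p → ∀ v → v ∈ V G → Adj G v (p v) × p (p v) ≡ v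

matchCut : ∀ {n} → MGraph n → Subset n → (Fin n → Fin n) → ℕ
matchCut G X p = ∑ (λ v →
  if (v ∈ᵇ V G) ∧ (v ∈ᵇ X) ∧ not (p v ∈ᵇ X) then 1 else 0)

Tight : ∀ {n} → MGraph n → Subset n → Set
Tight G X = ∀ (M : PerfectMatching G) → matchCut G X (proj₁ M) ≡ 1

-- G / X : shrink X to a single new vertex (index zero), deleting the loops;
-- the old vertex v becomes suc v.  Vertex set: {zero} ∪ (V(G) ∖ X).
_/_ : ∀ {n} → MGraph n → Subset n → MGraph (suc n)
_/_ {n} G X = mgraph (true ∷ (V G ─ X)) m'
  where
    out : Fin n → Bool
    out v = v ∈ᵇ (V G ─ X)
    m' : Fin (suc n) → Fin (suc n) → ℕ
    m' zero    zero    = 0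
    m' zero    (suc v) = if out v then ∑ (λ x → if x ∈ᵇ X then m G x v else 0) else 0
    m' (suc u) zero    = if out u then ∑ (λ x → if x ∈ᵇ X then m G u x else 0) else 0
    m' (suc u) (suc v) = if out u ∧ out v then m G u v else 0

ThreeConnectedSimpleCubic : ∀ {n} → MGraph n → Set
ThreeConnectedSimpleCubic G = KConnected 3 G × Simple G × Cubic G

-- In a 3-connected cubic graph every component of G − S has at least three edges leaving it, all of them
-- ending in S, while S sends out at most 3∣S∣ edges. Since G − S has ∣S∣ odd components, this forces every
-- component to be odd, every cut ∂(K) to have exactly three edges, and S to be independent. A perfect matching
-- must leave each odd component (parity), and its edges leaving components end in distinct vertices of S, so it
-- meets each ∂(K) exactly once. If two edges of ∂(K) shared an end, at most two vertices would separate K from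
-- the rest of G; and contracting either side of a 3-cut that is a matching keeps the graph simple, cubic and
-- 3-connected. For (iii), counting edges modulo 3 shows that the three edges leaving a bipartite component start
-- in one colour class; colouring S opposite to these classes 2-colours G.
module Submission where

open import Defs
open import Data.Nat using (ℕ; _≤_)
open import Data.Fin.Subset using (Subset; ⊤; _─_; ∣_∣)
open import Data.Product using (∃; _×_)
open import Relation.Binary.PropositionalEquality using (_≡_)
open import Relation.Nullary using (¬_)

open import Data.Bool using (Bool; true; false; _∧_; _∨_; not; _xor_; if_then_else_) renaming (_≟_ to _≟ᵇ_)
open import Data.Bool.Properties using (∧-zeroʳ; ∧-identityʳ; ∧-comm; if-eta; not-injective)
open import Data.Empty using (⊥; ⊥-elim)
open import Data.Fin using (Fin; zero; suc; toℕ)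
open import Data.Fin.Permutation using (permutation)
open import Data.Fin.Properties using (any?; all?; toℕ-injective) renaming (_≟_ to _≟ᶠ_; suc-injective to suc-injectiveᶠ)
open import Data.Fin.Subset using (_∈_; _∉_; _⊆_; _⊂_; _∪_; ⁅_⁆; Nonempty)
open import Data.Fin.Subset.Properties
  using (_∈?_; ∈⊤; ⊆-antisym; x∈p∧x∉q⇒x∈p─q; p⊆q⇒∣p∣≤∣q∣; p⊂q⇒∣p∣<∣q∣; ∣⁅x⁆∣≡1; x∈⁅y⁆⇒x≡y; x≢y⇒x∉⁅y⁆
        ; anySubset?; ∣p∣≤n; x∈⁅x⁆; drop-there; p⊆p∪q; x∈p∪q⁺; x∈p∪q⁻; p─q⊆p)
open import Data.Nat using (zero; suc; _+_; _*_; _<_; _<ᵇ_; z≤n; s≤s; _≤?_; _<?_)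
open import Data.Nat.Properties
open import Algebra.Properties.CommutativeMonoid.Sum +-0-commutativeMonoid
  using (sum; ∑-distrib-+; ∑-comm; ∑-permute)
open import Data.Product using (Σ; _,_; proj₁; proj₂)
open import Data.Sum using (_⊎_; inj₁; inj₂; [_,_])
open import Data.Vec using ([]; _∷_; lookup; tabulate; here; there)
open import Data.Vec.Properties using (≡-dec; []=⇒lookup; lookup⇒[]=; lookup∘tabulate; lookup-zipWith; lookup-replicate)
open import Data.Vec.Functional using () renaming (_∷_ to _∷ᶠ_)
open import Function using (_∘_)
open import Relation.Binary.PropositionalEquality using (_≢_; refl; sym; trans; cong; cong₂; subst; subst₂; module ≡-Reasoning)
open import Relation.Binary.Construct.Closure.ReflexiveTransitive using (Star; ε; _◅_; _◅◅_; reverse; gmap)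
open import Relation.Nullary using (Dec; yes; no; contradiction)
open import Relation.Nullary.Decidable using (_×-dec_; _→-dec_; ¬?; map′; decidable-stable)

true≢false : true ≢ false
true≢false ()

ind : Bool → ℕ
ind true  = 1
ind false = 0

ind-∨ : ∀ a b → ind (a ∨ b) ≤ ind a + ind b
ind-∨ true  b = s≤s z≤n
ind-∨ false b = ≤-refl

ind-pos≤ : ∀ k → ind (0 <ᵇ k) ≤ k
ind-pos≤ zero    = z≤n
ind-pos≤ (suc k) = s≤s z≤n

ind-pos<  : ∀ k → 2 ≤ k → ind (0 <ᵇ k) < k
ind-pos< (suc (suc k)) _ = s≤s (s≤s z≤n)
ind-pos< (suc zero) (s≤s ())

∑≡sum : ∀ {n} (f : Fin n → ℕ) → ∑ f ≡ sum f
∑≡sum {zero}  f = refl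
∑≡sum {suc n} f = cong (f zero +_) (∑≡sum (f ∘ suc))

∑-cong : ∀ {n} {f g : Fin n → ℕ} → (∀ i → f i ≡ g i) → ∑ f ≡ ∑ g
∑-cong {zero}  f≡g = refl
∑-cong {suc n} f≡g = cong₂ _+_ (f≡g zero) (∑-cong (f≡g ∘ suc))

∑-mono-≤ : ∀ {n} {f g : Fin n → ℕ} → (∀ i → f i ≤ g i) → ∑ f ≤ ∑ g
∑-mono-≤ {zero}  f≤g = z≤n
∑-mono-≤ {suc n} f≤g = +-mono-≤ (f≤g zero) (∑-mono-≤ (f≤g ∘ suc))

∑-mono-< : ∀ {n} {f g : Fin n → ℕ} → (∀ i → f i ≤ g i) → ∀ v → f v < g v → ∑ f < ∑ g
∑-mono-< f≤g zero    lt = +-mono-<-≤ lt (∑-mono-≤ (f≤g ∘ suc))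
∑-mono-< f≤g (suc v) lt = +-mono-≤-< (f≤g zero) (∑-mono-< (f≤g ∘ suc) v lt)

∑-zero : ∀ {n} → ∑ {n} (λ _ → 0) ≡ 0
∑-zero {zero}  = refl
∑-zero {suc n} = ∑-zero {n}

∑-+ : ∀ {n} (f g : Fin n → ℕ) → ∑ (λ i → f i + g i) ≡ ∑ f + ∑ g
∑-+ {n} f g = begin
  ∑ (λ i → f i + g i) ≡⟨ ∑≡sum (λ i → f i + g i) ⟩
  sum {n} (λ i → f i + g i) ≡⟨ ∑-distrib-+ f g ⟩
  sum f + sum g ≡⟨ sym (cong₂ _+_ (∑≡sum f) (∑≡sum g)) ⟩
  ∑ f + ∑ g ∎
  where open ≡-Reasoning

∑-swap : ∀ {a b} (f : Fin a → Fin b → ℕ) → ∑ (λ i → ∑ (f i)) ≡ ∑ (λ j → ∑ (λ i → f i j))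
∑-swap {a} {b} f = begin
  ∑ (λ i → ∑ (f i)) ≡⟨ ∑-cong (λ i → ∑≡sum (f i)) ⟩
  ∑ (λ i → sum {b} (f i)) ≡⟨ ∑≡sum (λ i → sum (f i)) ⟩
  sum {a} (λ i → sum (f i)) ≡⟨ ∑-comm f ⟩
  sum {b} (λ j → sum (λ i → f i j)) ≡⟨ sym (∑≡sum (λ j → sum (λ i → f i j))) ⟩
  ∑ (λ j → sum {a} (λ i → f i j)) ≡⟨ sym (∑-cong (λ j → ∑≡sum (λ i → f i j))) ⟩
  ∑ (λ j → ∑ (λ i → f i j)) ∎
  where open ≡-Reasoning

*-distribˡ-∑ : ∀ {n} c (f : Fin n → ℕ) → c * ∑ f ≡ ∑ (λ i → c * f i)
*-distribˡ-∑ {zero}  c f = *-zeroʳ c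
*-distribˡ-∑ {suc n} c f =
  trans (*-distribˡ-+ c (f zero) (∑ (f ∘ suc))) (cong (c * f zero +_) (*-distribˡ-∑ c (f ∘ suc)))

*-distribʳ-∑ : ∀ {n} c (f : Fin n → ℕ) → ∑ f * c ≡ ∑ (λ i → f i * c)
*-distribʳ-∑ c f = trans (*-comm (∑ f) c) (trans (*-distribˡ-∑ c f) (∑-cong (λ i → *-comm c (f i))))

f≤∑f : ∀ {n} (f : Fin n → ℕ) i → f i ≤ ∑ f
f≤∑f f zero    = m≤m+n _ _
f≤∑f f (suc i) = ≤-trans (f≤∑f (f ∘ suc) i) (m≤n+m _ (f zero))

∑-pos⇒pos : ∀ {n} (f : Fin n → ℕ) → 0 < ∑ f → ∃ λ i → 0 < f i
∑-pos⇒pos {suc n} f lt with f zero in f0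
... | suc _ = zero , subst (0 <_) (sym f0) (s≤s z≤n)
... | zero with ∑-pos⇒pos (f ∘ suc) lt
...   | i , fi>0 = suc i , fi>0

n*a≤∑ : ∀ {n} a (f : Fin n → ℕ) → (∀ i → a ≤ f i) → n * a ≤ ∑ f
n*a≤∑ {zero}  a f a≤f = z≤n
n*a≤∑ {suc n} a f a≤f = +-mono-≤ (a≤f zero) (n*a≤∑ a (f ∘ suc) (a≤f ∘ suc))

∑≤n*a⇒≡a : ∀ {n} a (f : Fin n → ℕ) → (∀ i → a ≤ f i) → ∑ f ≤ n * a → ∀ i → f i ≡ a
∑≤n*a⇒≡a {suc n} a f a≤f ∑≤ = at
  where
    rest≥ : n * a ≤ ∑ (f ∘ suc)
    rest≥ = n*a≤∑ a (f ∘ suc) (a≤f ∘ suc)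
    at : ∀ i → f i ≡ a
    at zero    = ≤-antisym (+-cancelʳ-≤ (n * a) (f zero) a (≤-trans (+-monoʳ-≤ (f zero) rest≥) ∑≤)) (a≤f zero)
    at (suc i) = ∑≤n*a⇒≡a a (f ∘ suc) (a≤f ∘ suc) (+-cancelˡ-≤ a _ _ (≤-trans (+-monoˡ-≤ _ (a≤f zero)) ∑≤)) i

∑-ind≤1 : ∀ {n} (b : Fin n → Bool) → (∀ i j → b i ≡ true → b j ≡ true → i ≡ j) → ∑ (ind ∘ b) ≤ 1
∑-ind≤1 {zero}  b unique = z≤n
∑-ind≤1 {suc n} b unique with b zero in b0
... | false = ∑-ind≤1 (b ∘ suc) (λ i j bi bj → suc-injectiveᶠ (unique (suc i) (suc j) bi bj))
... | true  = ≤-reflexive (cong suc (trans (∑-cong rest≡0) (∑-zero {n})))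
  where
    rest≡0 : ∀ i → ind (b (suc i)) ≡ 0
    rest≡0 i with b (suc i) in bi
    ... | false = refl
    ... | true  with () ← unique zero (suc i) b0 bi

∑-involution : ∀ {n} (p : Fin n → Fin n) → (∀ v → p (p v) ≡ v) → (f : Fin n → ℕ) → ∑ (f ∘ p) ≡ ∑ f
∑-involution p p∘p f = begin
  ∑ (f ∘ p) ≡⟨ ∑≡sum (f ∘ p) ⟩
  sum (f ∘ p) ≡⟨ sym (∑-permute f (permutation p p p∘p p∘p)) ⟩
  sum f ≡⟨ sym (∑≡sum f) ⟩
  ∑ f ∎
  where open ≡-Reasoning

∉⇒lookup≡false : ∀ {n} {x : Fin n} {p : Subset n} → x ∉ p → lookup p x ≡ false
∉⇒lookup≡false {x = x} {p} x∉p with lookup p x in px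
... | true  = ⊥-elim (x∉p (lookup⇒[]= x p px))
... | false = refl

lookup≡false⇒∉ : ∀ {n} {x : Fin n} {p : Subset n} → lookup p x ≡ false → x ∉ p
lookup≡false⇒∉ px≡false x∈p with () ← trans (sym ([]=⇒lookup x∈p)) px≡false

lookup-─ : ∀ {n} (p q : Subset n) i → lookup (p ─ q) i ≡ lookup p i ∧ not (lookup q i)
lookup-─ (x ∷ p) (true  ∷ q) zero    = sym (∧-zeroʳ x)
lookup-─ (x ∷ p) (false ∷ q) zero    = sym (∧-identityʳ x)
lookup-─ (x ∷ p) (y     ∷ q) (suc i) = lookup-─ p q i

lookup-⊤─ : ∀ {n} (q : Subset n) i → lookup (⊤ ─ q) i ≡ not (lookup q i)
lookup-⊤─ q i = trans (lookup-─ ⊤ q i) (cong (_∧ not (lookup q i)) (lookup-replicate i true))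

∉⇒∈⊤─ : ∀ {n} {x : Fin n} {q : Subset n} → x ∉ q → x ∈ ⊤ ─ q
∉⇒∈⊤─ = x∈p∧x∉q⇒x∈p─q ∈⊤

∈─⇒∉ : ∀ {n} {x : Fin n} {p q : Subset n} → x ∈ p ─ q → x ∉ q
∈─⇒∉ {x = x} {p} {q} x∈p─q x∈q = true≢false (begin
  true ≡⟨ sym ([]=⇒lookup x∈p─q) ⟩
  lookup (p ─ q) x ≡⟨ lookup-─ p q x ⟩
  lookup p x ∧ not (lookup q x) ≡⟨ cong (λ b → lookup p x ∧ not b) ([]=⇒lookup x∈q) ⟩
  lookup p x ∧ false ≡⟨ ∧-zeroʳ _ ⟩
  false ∎)
  where open ≡-Reasoning

⊤─⊤─p≡p : ∀ {n} (p : Subset n) → ⊤ ─ (⊤ ─ p) ≡ p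
⊤─⊤─p≡p []          = refl
⊤─⊤─p≡p (true  ∷ p) = cong (true  ∷_) (⊤─⊤─p≡p p)
⊤─⊤─p≡p (false ∷ p) = cong (false ∷_) (⊤─⊤─p≡p p)

∣p∣≡∑ind : ∀ {n} (p : Subset n) → ∣ p ∣ ≡ ∑ (ind ∘ lookup p)
∣p∣≡∑ind []          = refl
∣p∣≡∑ind (true  ∷ p) = cong suc (∣p∣≡∑ind p)
∣p∣≡∑ind (false ∷ p) = ∣p∣≡∑ind p

∣p∪q∣≤∣p∣+∣q∣ : ∀ {n} (p q : Subset n) → ∣ p ∪ q ∣ ≤ ∣ p ∣ + ∣ q ∣
∣p∪q∣≤∣p∣+∣q∣ p q = begin
  ∣ p ∪ q ∣ ≡⟨ ∣p∣≡∑ind (p ∪ q) ⟩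
  ∑ (λ i → ind (lookup (p ∪ q) i)) ≡⟨ ∑-cong (λ i → cong ind (lookup-zipWith _∨_ i p q)) ⟩
  ∑ (λ i → ind (lookup p i ∨ lookup q i)) ≤⟨ ∑-mono-≤ (λ i → ind-∨ (lookup p i) (lookup q i)) ⟩
  ∑ (λ i → ind (lookup p i) + ind (lookup q i)) ≡⟨ ∑-+ (ind ∘ lookup p) (ind ∘ lookup q) ⟩
  ∑ (ind ∘ lookup p) + ∑ (ind ∘ lookup q) ≡⟨ sym (cong₂ _+_ (∣p∣≡∑ind p) (∣p∣≡∑ind q)) ⟩
  ∣ p ∣ + ∣ q ∣ ∎
  where open ≤-Reasoning

∣q∣<∣p∣⇒∃∈p∉q : ∀ {n} (p q : Subset n) → ∣ q ∣ < ∣ p ∣ → ∃ λ v → v ∈ p × v ∉ q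
∣q∣<∣p∣⇒∃∈p∉q p q ∣q∣<∣p∣ with any? (λ v → (v ∈? p) ×-dec ¬? (v ∈? q))
... | yes found = found
... | no none   = contradiction (p⊆q⇒∣p∣≤∣q∣ p⊆q) (<⇒≱ ∣q∣<∣p∣)
  where
    p⊆q : p ⊆ q
    p⊆q {v} v∈p = decidable-stable (v ∈? q) (λ v∉q → none (v , v∈p , v∉q))

∣p∣≤1⇒≡ : ∀ {n} (p : Subset n) {u w} → ∣ p ∣ ≤ 1 → u ∈ p → w ∈ p → u ≡ w
∣p∣≤1⇒≡ p {u} {w} ∣p∣≤1 u∈p w∈p with u ≟ᶠ w
... | yes u≡w = u≡w
... | no  u≢w = contradiction (≤-trans ⁅u⁆<p ∣p∣≤1) (<-irrefl refl)
  where
    ⁅u⁆<p : 1 < ∣ p ∣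
    ⁅u⁆<p = subst (_< ∣ p ∣) (∣⁅x⁆∣≡1 u)
      (p⊂q⇒∣p∣<∣q∣ ((λ x∈⁅u⁆ → subst (_∈ p) (sym (x∈⁅y⁆⇒x≡y u x∈⁅u⁆)) u∈p) , w , w∈p , x≢y⇒x∉⁅y⁆ (u≢w ∘ sym)))

ind-─-split : ∀ {n} {P Q : Subset n} → P ⊆ Q → ∀ v → ind (lookup P v) + ind (lookup (Q ─ P) v) ≡ ind (lookup Q v)
ind-─-split {P = P} {Q} P⊆Q v rewrite lookup-─ Q P v with lookup P v in Pv
... | true  rewrite []=⇒lookup (P⊆Q (lookup⇒[]= v P Pv)) = refl
... | false = cong ind (∧-identityʳ (lookup Q v))

<ᵇ-total : ∀ a b → a ≢ b → ind (a <ᵇ b) + ind (b <ᵇ a) ≡ 1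
<ᵇ-total zero    zero    a≢b = ⊥-elim (a≢b refl)
<ᵇ-total zero    (suc b) a≢b = refl
<ᵇ-total (suc a) zero    a≢b = refl
<ᵇ-total (suc a) (suc b) a≢b = <ᵇ-total a b (a≢b ∘ cong suc)

-- Each orbit {v, p v} contributes to half exactly once, through its smaller element.
involution-invariant⇒even : ∀ {n} (p : Fin n → Fin n) → (∀ v → p (p v) ≡ v) → (∀ v → p v ≢ v) →
                            ∀ L → (∀ v → lookup L (p v) ≡ lookup L v) → ∃ λ a → ∣ L ∣ ≡ a + a
involution-invariant⇒even p p∘p p≢id L L∘p≡L = half , (begin
  ∣ L ∣ ≡⟨ ∣p∣≡∑ind L ⟩
  ∑ (λ v → ind (lookup L v)) ≡⟨ ∑-cong (λ v → sym (trans (cong (ind (lookup L v) *_) (<ᵇ-total _ _ (p≢id v ∘ sym ∘ toℕ-injective)))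
                                                     (*-identityʳ _))) ⟩
  ∑ (λ v → ind (lookup L v) * (ind (before v (p v)) + ind (before (p v) v))) ≡⟨ ∑-cong (λ v → *-distribˡ-+ (ind (lookup L v)) _ _) ⟩
  ∑ (λ v → ind (lookup L v) * ind (before v (p v)) + ind (lookup L v) * ind (before (p v) v))
    ≡⟨ ∑-+ (λ v → ind (lookup L v) * ind (before v (p v))) (λ v → ind (lookup L v) * ind (before (p v) v)) ⟩
  half + ∑ (λ v → ind (lookup L v) * ind (before (p v) v))
    ≡⟨ cong (half +_) (sym (∑-involution p p∘p (λ v → ind (lookup L v) * ind (before (p v) v)))) ⟩
  half + ∑ (λ v → ind (lookup L (p v)) * ind (before (p (p v)) (p v)))
    ≡⟨ cong (half +_) (∑-cong (λ v → cong₂ (λ b w → ind b * ind (before w (p v))) (L∘p≡L v) (p∘p v))) ⟩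
  half + half ∎)
  where
    open ≡-Reasoning
    before : Fin _ → Fin _ → Bool
    before u v = toℕ u <ᵇ toℕ v
    half : ℕ
    half = ∑ (λ v → ind (lookup L v) * ind (before v (p v)))

support : ∀ {n} → (Fin n → ℕ) → Subset n
support f = tabulate (λ i → 0 <ᵇ f i)

lookup-support : ∀ {n} (f : Fin n → ℕ) i → lookup (support f) i ≡ (0 <ᵇ f i)
lookup-support f = lookup∘tabulate (λ i → 0 <ᵇ f i)

0<⇒∈support : ∀ {n} (f : Fin n → ℕ) {i} → 0 < f i → i ∈ support f
0<⇒∈support f {i} 0<fi with f i in fi
... | suc _ = lookup⇒[]= i (support f) (trans (lookup-support f i) (cong (0 <ᵇ_) fi))

∈support⇒0< : ∀ {n} (f : Fin n → ℕ) {i} → i ∈ support f → 0 < f i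
∈support⇒0< f {i} i∈ with f i in fi | trans (sym (lookup-support f i)) ([]=⇒lookup i∈)
... | suc _ | _ = s≤s z≤n

∣support∣≤∑ : ∀ {n} (f : Fin n → ℕ) → ∣ support f ∣ ≤ ∑ f
∣support∣≤∑ f = begin
  ∣ support f ∣ ≡⟨ ∣p∣≡∑ind (support f) ⟩
  ∑ (ind ∘ lookup (support f)) ≡⟨ ∑-cong (cong ind ∘ lookup-support f) ⟩
  ∑ (λ i → ind (0 <ᵇ f i)) ≤⟨ ∑-mono-≤ (ind-pos≤ ∘ f) ⟩
  ∑ f ∎
  where open ≤-Reasoning

∣support∣<∑ : ∀ {n} (f : Fin n → ℕ) v → 2 ≤ f v → ∣ support f ∣ < ∑ f
∣support∣<∑ f v 2≤fv = begin-strict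
  ∣ support f ∣ ≡⟨ ∣p∣≡∑ind (support f) ⟩
  ∑ (ind ∘ lookup (support f)) ≡⟨ ∑-cong (cong ind ∘ lookup-support f) ⟩
  ∑ (λ i → ind (0 <ᵇ f i)) <⟨ ∑-mono-< (ind-pos≤ ∘ f) v (ind-pos< (f v) 2≤fv) ⟩
  ∑ f ∎
  where open ≤-Reasoning

module _ {n} (G : MGraph n) where

  walk-stays : ∀ {W u v} → Star (StepIn G W) u v → u ∈ W → v ∈ W
  walk-stays ε                 u∈W = u∈W
  walk-stays ((_ , v∈W , _) ◅ walk) _ = walk-stays walk v∈W

  walk-restrict : ∀ {W R u v} → (∀ {x y} → x ∈ R → StepIn G W x y → y ∈ R) →
                  Star (StepIn G W) u v → u ∈ R → Star (StepIn G R) u v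
  walk-restrict closed ε                      u∈R = ε
  walk-restrict closed (step@(_ , _ , adj) ◅ walk) u∈R =
    (u∈R , closed u∈R step , adj) ◅ walk-restrict closed walk (closed u∈R step)

  walk-reverse : (∀ u v → m G u v ≡ m G v u) → ∀ {W u v} → Star (StepIn G W) u v → Star (StepIn G W) v u
  walk-reverse msym = reverse (λ { {u} {v} (u∈W , v∈W , adj) → v∈W , u∈W , subst (0 <_) (msym u v) adj })

record Reachable {n} (G : MGraph n) (W : Subset n) (a : Fin n) : Set where
  field
    R      : Subset n
    a∈R    : a ∈ R
    walkTo : ∀ {v} → v ∈ R → Star (StepIn G W) a v
    closed : ∀ {u v} → u ∈ R → StepIn G W u v → v ∈ R

-- R gains a vertex in each round, so n rounds suffice.
reachable : ∀ {n} (G : MGraph n) W a → Reachable G W a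
reachable {n} G W a = grow n ⁅ a ⁆ fuel-enough (λ v∈⁅a⁆ → subst (Star _ a) (sym (x∈⁅y⁆⇒x≡y a v∈⁅a⁆)) ε) (x∈⁅x⁆ a)
  where
    LeavingStep : Subset n → Set
    LeavingStep R = ∃ λ u → ∃ λ v → u ∈ R × StepIn G W u v × v ∉ R

    leavingStep? : ∀ R → Dec (LeavingStep R)
    leavingStep? R = any? λ u → any? λ v →
      (u ∈? R) ×-dec ((u ∈? W) ×-dec (v ∈? W) ×-dec (0 <? m G u v)) ×-dec ¬? (v ∈? R)

    fuel-enough : n < ∣ ⁅ a ⁆ ∣ + n
    fuel-enough = subst (λ k → n < k + n) (sym (∣⁅x⁆∣≡1 a)) ≤-refl

    grow : ∀ fuel R → n < ∣ R ∣ + fuel → (∀ {v} → v ∈ R → Star (StepIn G W) a v) → a ∈ R → Reachable G W a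
    grow zero R n<∣R∣ _ _ = contradiction (subst (n <_) (+-identityʳ _) n<∣R∣) (≤⇒≯ (∣p∣≤n R))
    grow (suc fuel) R n<∣R∣+fuel walkTo a∈R with leavingStep? R
    ... | no none = record { R = R ; a∈R = a∈R ; walkTo = walkTo ; closed = closed }
      where
        closed : ∀ {u v} → u ∈ R → StepIn G W u v → v ∈ R
        closed {u} {v} u∈R step = decidable-stable (v ∈? R) (λ v∉R → none (u , v , u∈R , step , v∉R))
    ... | yes (u , v , u∈R , step , v∉R) = grow fuel (R ∪ ⁅ v ⁆) enough walkTo′ (p⊆p∪q ⁅ v ⁆ a∈R)
      where
        R⊂R′ : R ⊂ R ∪ ⁅ v ⁆
        R⊂R′ = p⊆p∪q ⁅ v ⁆ , v , x∈p∪q⁺ (inj₂ (x∈⁅x⁆ v)) , v∉R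
        enough : n < ∣ R ∪ ⁅ v ⁆ ∣ + fuel
        enough = <-≤-trans (subst (n <_) (+-suc ∣ R ∣ fuel) n<∣R∣+fuel) (+-monoˡ-≤ fuel (p⊂q⇒∣p∣<∣q∣ R⊂R′))
        walkTo′ : ∀ {x} → x ∈ R ∪ ⁅ v ⁆ → Star (StepIn G W) a x
        walkTo′ {x} x∈R′ with x∈p∪q⁻ R ⁅ v ⁆ x∈R′
        ... | inj₁ x∈R   = walkTo x∈R
        ... | inj₂ x∈⁅v⁆ = subst (Star _ a) (sym (x∈⁅y⁆⇒x≡y v x∈⁅v⁆)) (walkTo u∈R ◅◅ (step ◅ ε))

module _ {n} {G : MGraph n} {S : Subset n} where

  component-⊆ : ∀ {K L w} → IsComponent G S K → IsComponent G S L → w ∈ K → w ∈ L → K ⊆ L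
  component-⊆ {K} {L} {w} (K⊆V─S , _ , connK , _) (_ , _ , _ , closedL) w∈K w∈L {v} v∈K =
    follow w∈L (connK w v w∈K v∈K)
    where
      follow : ∀ {u} → u ∈ L → Star (StepIn G K) u v → v ∈ L
      follow u∈L ε = u∈L
      follow u∈L ((_ , u′∈K , adj) ◅ walk) =
        follow (closedL _ _ u∈L (p─q⊆p _ S (K⊆V─S u′∈K)) (∈─⇒∉ (K⊆V─S u′∈K)) adj) walk

  component-≡ : ∀ {K L w} → IsComponent G S K → IsComponent G S L → w ∈ K → w ∈ L → K ≡ L
  component-≡ cK cL w∈K w∈L = ⊆-antisym (component-⊆ cK cL w∈K w∈L) (component-⊆ cL cK w∈L w∈K)

  componentOf : (∀ u v → m G u v ≡ m G v u) → ∀ {v} → v ∈ V G → v ∉ S → ∃ λ K → IsComponent G S K × v ∈ K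
  componentOf msym {v} v∈V v∉S = R , (R⊆W , (v , a∈R) , connected , closedOut) , a∈R
    where
      open Reachable (reachable G (V G ─ S) v)
      R⊆W : R ⊆ V G ─ S
      R⊆W u∈R = walk-stays G (walkTo u∈R) (x∈p∧x∉q⇒x∈p─q v∈V v∉S)
      connected : ConnectedSet G R
      connected x y x∈R y∈R = walk-restrict G closed (walk-reverse G msym (walkTo x∈R) ◅◅ walkTo y∈R) x∈R
      closedOut : ∀ x y → x ∈ R → y ∈ V G → y ∉ S → Adj G x y → y ∈ R
      closedOut x y x∈R y∈V y∉S adj = closed x∈R (R⊆W x∈R , x∈p∧x∉q⇒x∈p─q y∈V y∉S , adj)

module Edges {n} (m : Fin n → Fin n → ℕ) where

  G : MGraph n
  G = mgraph ⊤ m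

  edgeCount : Subset n → Subset n → Fin n → Fin n → ℕ
  edgeCount X P u v = ind (lookup X u) * ind (lookup P v) * m u v

  edgesFrom : Subset n → Subset n → Fin n → ℕ
  edgesFrom X P u = ∑ (edgeCount X P u)

  edges : Subset n → Subset n → ℕ
  edges X P = ∑ (edgesFrom X P)

  boundary : Subset n → Subset n → Subset n
  boundary X P = support (edgesFrom X P)

  ind∈ : ∀ {x : Fin n} {X} → x ∈ X → ind (lookup X x) ≡ 1
  ind∈ x∈X = cong ind ([]=⇒lookup x∈X)

  0<edgeCount⇒adj : ∀ {X P u v} → 0 < edgeCount X P u v → u ∈ X × v ∈ P × Adj G u v
  0<edgeCount⇒adj {X} {P} {u} {v} 0<count with lookup X u in Xu | lookup P v in Pv
  ... | true | true = lookup⇒[]= u X Xu , lookup⇒[]= v P Pv , subst (0 <_) (+-identityʳ (m u v)) 0<count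

  adj⇒0<edgesFrom : ∀ {X P u v} → u ∈ X → v ∈ P → Adj G u v → 0 < edgesFrom X P u
  adj⇒0<edgesFrom {X} {P} {u} {v} u∈X v∈P adj = <-≤-trans adj (begin
    m u v ≡⟨ sym (*-identityˡ (m u v)) ⟩
    1 * 1 * m u v ≡⟨ sym (cong₂ (λ a b → a * b * m u v) (ind∈ u∈X) (ind∈ v∈P)) ⟩
    ind (lookup X u) * ind (lookup P v) * m u v ≤⟨ f≤∑f _ v ⟩
    edgesFrom X P u ∎)
    where open ≤-Reasoning

  adj⇒∈boundary : ∀ {X P u v} → u ∈ X → v ∈ P → Adj G u v → u ∈ boundary X P
  adj⇒∈boundary {X} {P} u∈X v∈P adj = 0<⇒∈support (edgesFrom X P) (adj⇒0<edgesFrom u∈X v∈P adj)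

  adj⇒0<edges : ∀ {X P u v} → u ∈ X → v ∈ P → Adj G u v → 0 < edges X P
  adj⇒0<edges {X} {P} {u} u∈X v∈P adj = <-≤-trans (adj⇒0<edgesFrom u∈X v∈P adj) (f≤∑f (edgesFrom X P) u)

  ∈boundary⇒ : ∀ {X P u} → u ∈ boundary X P → u ∈ X × ∃ λ v → v ∈ P × Adj G u v
  ∈boundary⇒ {X} {P} {u} u∈bd with ∑-pos⇒pos (edgeCount X P u) (∈support⇒0< (edgesFrom X P) u∈bd)
  ... | v , 0<count with u∈X , v∈P , adj ← 0<edgeCount⇒adj 0<count = u∈X , v , v∈P , adj

  ∣boundary∣≤edges : ∀ X P → ∣ boundary X P ∣ ≤ edges X P
  ∣boundary∣≤edges X P = ∣support∣≤∑ (edgesFrom X P)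

  edges-sym : (∀ u v → m u v ≡ m v u) → ∀ X P → edges X P ≡ edges P X
  edges-sym msym X P = trans (∑-swap {n} {n} λ u v → ind (lookup X u) * ind (lookup P v) * m u v) (∑-cong λ v → ∑-cong λ u →
    cong₂ _*_ (*-comm (ind (lookup X u)) (ind (lookup P v))) (msym u v))

  cutSize≡edges : ∀ X → cutSize G X ≡ edges X (⊤ ─ X)
  cutSize≡edges X = ∑-cong λ u → ∑-cong λ v →
    trans (if∧not (lookup X u) (lookup X v) (m u v))
          (cong (λ b → ind (lookup X u) * ind b * m u v) (sym (lookup-⊤─ X v)))
    where
      if∧not : ∀ a b x → (if a ∧ not b then x else 0) ≡ ind a * ind (not b) * x
      if∧not true  true  x = refl
      if∧not true  false x = sym (+-identityʳ x)
      if∧not false b     x = refl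

  cutSize≡edges-outside : (∀ u v → m u v ≡ m v u) → ∀ X → cutSize G X ≡ edges (⊤ ─ X) X
  cutSize≡edges-outside msym X = trans (cutSize≡edges X) (edges-sym msym X (⊤ ─ X))

  cutDeg-complement : ∀ X v → cutDeg G (⊤ ─ X) v ≡ cutDeg G X v
  cutDeg-complement X v = ∑-cong λ u →
    cong (λ b → if b then m v u else 0) (trans (cong₂ _xor_ (lookup-⊤─ X v) (lookup-⊤─ X u)) (not-xor-not (lookup X v) (lookup X u)))
    where
      not-xor-not : ∀ a b → not a xor not b ≡ a xor b
      not-xor-not true  true  = refl
      not-xor-not true  false = refl
      not-xor-not false true  = refl
      not-xor-not false false = refl

  cutDeg≡edgesFrom-in : ∀ X {v} → v ∈ X → cutDeg G X v ≡ edgesFrom X (⊤ ─ X) v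
  cutDeg≡edgesFrom-in X {v} v∈X = ∑-cong λ u →
    trans (if-xor (lookup X u) (m v u))
          (cong₂ (λ a b → a * ind b * m v u) (sym (ind∈ v∈X)) (sym (lookup-⊤─ X u)))
    where
      if-xor : ∀ b x → (if lookup X v xor b then x else 0) ≡ 1 * ind (not b) * x
      if-xor b x rewrite []=⇒lookup v∈X with b
      ... | true  = refl
      ... | false = sym (+-identityʳ x)

  cutDeg≡edgesFrom-out : ∀ X {v} → v ∉ X → cutDeg G X v ≡ edgesFrom (⊤ ─ X) X v
  cutDeg≡edgesFrom-out X {v} v∉X = ∑-cong λ u →
    trans (if-xor (lookup X u) (m v u))
          (cong (λ a → ind a * ind (lookup X u) * m v u) (sym (trans (lookup-⊤─ X v) (cong not (∉⇒lookup≡false v∉X)))))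
    where
      if-xor : ∀ b x → (if lookup X v xor b then x else 0) ≡ ind true * ind b * x
      if-xor b x rewrite ∉⇒lookup≡false v∉X with b
      ... | true  = sym (+-identityʳ x)
      ... | false = refl

  edgeCount-monoˡ : ∀ {X X′ P u v} → (u ∈ X → v ∈ P → Adj G u v → u ∈ X′) → edgeCount X P u v ≤ edgeCount X′ P u v
  edgeCount-monoˡ {X} {X′} {P} {u} {v} X⇒X′ with edgeCount X P u v in t
  ... | zero  = z≤n
  ... | suc _ with u∈X , v∈P , adj ← 0<edgeCount⇒adj (subst (0 <_) (sym t) (s≤s z≤n)) =
    ≤-reflexive (trans (sym t) (cong (λ a → a * ind (lookup P v) * m u v)
                                     (trans (ind∈ u∈X) (sym (ind∈ (X⇒X′ u∈X v∈P adj))))))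

  edgeCount-congʳ : ∀ {X P P′ u v} → (u ∈ X → Adj G u v → lookup P v ≡ lookup P′ v) → edgeCount X P u v ≡ edgeCount X P′ u v
  edgeCount-congʳ {X} {P} {P′} {u} {v} P≡P′ with lookup X u in Xu
  ... | false = refl
  ... | true with m u v in muv
  ...   | zero  = trans (*-zeroʳ (1 * ind (lookup P v))) (sym (*-zeroʳ (1 * ind (lookup P′ v))))
  ...   | suc k = cong (λ b → 1 * ind b * suc k) (P≡P′ (lookup⇒[]= u X Xu) (s≤s z≤n))

  edges-monoˡ : ∀ {X X′ P} → (∀ {u v} → u ∈ X → v ∈ P → Adj G u v → u ∈ X′) → edges X P ≤ edges X′ P
  edges-monoˡ {X} {X′} {P} X⇒X′ = ∑-mono-≤ λ u → ∑-mono-≤ λ v → edgeCount-monoˡ {X} {X′} {P} {u} {v} X⇒X′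

  edges-congʳ : ∀ {X P P′} → (∀ {u v} → u ∈ X → Adj G u v → lookup P v ≡ lookup P′ v) → edges X P ≡ edges X P′
  edges-congʳ {X} {P} {P′} P≡P′ = ∑-cong λ u → ∑-cong λ v → edgeCount-congʳ {X} {P} {P′} {u} {v} P≡P′

  edges-+ˡ : ∀ {A B X} P → (∀ u → ind (lookup A u) + ind (lookup B u) ≡ ind (lookup X u)) →
             edges A P + edges B P ≡ edges X P
  edges-+ˡ {A} {B} {X} P A+B≡X = begin
    edges A P + edges B P ≡⟨ sym (∑-+ (edgesFrom A P) (edgesFrom B P)) ⟩
    ∑ (λ u → edgesFrom A P u + edgesFrom B P u) ≡⟨ ∑-cong (λ u → sym (∑-+ (edgeCount A P u) (edgeCount B P u))) ⟩
    ∑ (λ u → ∑ λ v → edgeCount A P u v + edgeCount B P u v) ≡⟨ ∑-cong (λ u → ∑-cong λ v → pointwise u v) ⟩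
    edges X P ∎
    where
      open ≡-Reasoning
      pointwise : ∀ u v → edgeCount A P u v + edgeCount B P u v ≡ edgeCount X P u v
      pointwise u v = let a = ind (lookup A u); b = ind (lookup B u); p = ind (lookup P v) in
        trans (sym (*-distribʳ-+ (m u v) (a * p) (b * p)))
              (cong (_* m u v) (trans (sym (*-distribʳ-+ p a b)) (cong (_* p) (A+B≡X u))))

  edges-+ʳ : ∀ X {P P′ Q} → (∀ v → ind (lookup P v) + ind (lookup P′ v) ≡ ind (lookup Q v)) →
             edges X P + edges X P′ ≡ edges X Q
  edges-+ʳ X {P} {P′} {Q} P+P′≡Q = begin
    edges X P + edges X P′ ≡⟨ sym (∑-+ (edgesFrom X P) (edgesFrom X P′)) ⟩
    ∑ (λ u → edgesFrom X P u + edgesFrom X P′ u) ≡⟨ ∑-cong (λ u → sym (∑-+ (edgeCount X P u) (edgeCount X P′ u))) ⟩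
    ∑ (λ u → ∑ λ v → edgeCount X P u v + edgeCount X P′ u v) ≡⟨ ∑-cong (λ u → ∑-cong λ v → pointwise u v) ⟩
    edges X Q ∎
    where
      open ≡-Reasoning
      pointwise : ∀ u v → edgeCount X P u v + edgeCount X P′ u v ≡ edgeCount X Q u v
      pointwise u v = let x = ind (lookup X u); p = ind (lookup P v); p′ = ind (lookup P′ v) in
        trans (sym (*-distribʳ-+ (m u v) (x * p) (x * p′)))
              (cong (_* m u v) (trans (sym (*-distribˡ-+ x p p′)) (cong (x *_) (P+P′≡Q v))))

  ∑edges≤ : ∀ {j} X (F : Fin j → Subset n) Q → (∀ v → ∑ (λ i → ind (lookup (F i) v)) ≤ ind (lookup Q v)) →
            ∑ (λ i → edges X (F i)) ≤ edges X Q
  ∑edges≤ X F Q disjoint = begin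
    ∑ (λ i → ∑ λ u → ∑ λ v → edgeCount X (F i) u v) ≡⟨ ∑-swap (λ i u → ∑ λ v → edgeCount X (F i) u v) ⟩
    ∑ (λ u → ∑ λ i → ∑ λ v → edgeCount X (F i) u v) ≡⟨ ∑-cong (λ u → ∑-swap (λ i v → edgeCount X (F i) u v)) ⟩
    ∑ (λ u → ∑ λ v → ∑ λ i → edgeCount X (F i) u v) ≡⟨ ∑-cong (λ u → ∑-cong λ v → pull-out u v) ⟩
    ∑ (λ u → ∑ λ v → ind (lookup X u) * ∑ (λ i → ind (lookup (F i) v)) * m u v)
      ≤⟨ ∑-mono-≤ (λ u → ∑-mono-≤ λ v → *-monoˡ-≤ (m u v) (*-monoʳ-≤ (ind (lookup X u)) (disjoint v))) ⟩
    edges X Q ∎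
    where
      open ≤-Reasoning
      pull-out : ∀ u v → ∑ (λ i → edgeCount X (F i) u v) ≡ ind (lookup X u) * ∑ (λ i → ind (lookup (F i) v)) * m u v
      pull-out u v = let x = ind (lookup X u) in sym (begin-equality
        x * ∑ (λ i → ind (lookup (F i) v)) * m u v
          ≡⟨ cong (_* m u v) (*-distribˡ-∑ x (λ i → ind (lookup (F i) v))) ⟩
        ∑ (λ i → x * ind (lookup (F i) v)) * m u v
          ≡⟨ *-distribʳ-∑ (m u v) (λ i → x * ind (lookup (F i) v)) ⟩
        ∑ (λ i → edgeCount X (F i) u v) ∎)

  edges-⊤ : (∀ v → ∑ (m v) ≡ 3) → ∀ X → edges X ⊤ ≡ ∣ X ∣ * 3
  edges-⊤ cubic X = begin
    edges X ⊤ ≡⟨ ∑-cong (λ u → ∑-cong λ v → cong (λ b → ind (lookup X u) * ind b * m u v) (lookup-replicate v true)) ⟩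
    ∑ (λ u → ∑ λ v → ind (lookup X u) * 1 * m u v) ≡⟨ ∑-cong (λ u → sym (*-distribˡ-∑ (ind (lookup X u) * 1) (m u))) ⟩
    ∑ (λ u → ind (lookup X u) * 1 * ∑ (m u)) ≡⟨ ∑-cong (λ u → cong₂ _*_ (*-identityʳ (ind (lookup X u))) (cubic u)) ⟩
    ∑ (λ u → ind (lookup X u) * 3) ≡⟨ sym (*-distribʳ-∑ 3 (ind ∘ lookup X)) ⟩
    ∑ (ind ∘ lookup X) * 3 ≡⟨ cong (_* 3) (sym (∣p∣≡∑ind X)) ⟩
    ∣ X ∣ * 3 ∎
    where open ≡-Reasoning

module ThreeConnected {n} (m : Fin n → Fin n → ℕ) (msym : ∀ u v → m u v ≡ m v u)
                      (conn : ∀ X → ∣ X ∣ < 3 → ConnectedOn (mgraph ⊤ m) (⊤ ─ X)) where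

  open Edges m

  adj-sym : ∀ {u v} → Adj G u v → Adj G v u
  adj-sym {u} {v} = subst (0 <_) (msym u v)

  Separates : Subset n → Subset n → Set
  Separates X P = ∀ {u w} → u ∈ P → w ∉ P → Adj G u w → u ∈ X ⊎ w ∈ X

  separator-≥3 : ∀ {X P x y} → Separates X P → x ∈ P → x ∉ X → y ∉ P → y ∉ X → 3 ≤ ∣ X ∣
  separator-≥3 {X} {P} {x} {y} sep x∈P x∉X y∉P y∉X =
    ≮⇒≥ λ ∣X∣<3 → escape x∈P (proj₂ (conn X ∣X∣<3) x y (∉⇒∈⊤─ x∉X) (∉⇒∈⊤─ y∉X))
    where
      escape : ∀ {u} → u ∈ P → Star (StepIn G (⊤ ─ X)) u y → ⊥
      escape u∈P ε = y∉P u∈P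
      escape u∈P (_◅_ {j = w} (u∈W , w∈W , adj) walk) with w ∈? P
      ... | yes w∈P = escape w∈P walk
      ... | no  w∉P = [ ∈─⇒∉ u∈W , ∈─⇒∉ w∈W ] (sep u∈P w∉P adj)

  module _ (X Y : Subset n) where

    W : Subset n
    W = ⊤ ─ X ─ Y

    ∈W⇒∉X : ∀ {v} → v ∈ W → v ∉ X
    ∈W⇒∉X v∈W = ∈─⇒∉ (p─q⊆p (⊤ ─ X) Y v∈W)

    ClosedIn : Subset n → Set
    ClosedIn P = P ⊆ W × ∀ {u w} → u ∈ P → w ∈ W → Adj G u w → w ∈ P

    closedIn-edges≥2 : ∀ {P x y} → ∣ Y ∣ ≤ 1 → ClosedIn P → x ∈ P → y ∈ W → y ∉ P → 2 ≤ edges X P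
    closedIn-edges≥2 {P} {x} {y} ∣Y∣≤1 (P⊆W , closed) x∈P y∈W y∉P = +-cancelˡ-≤ 1 2 (edges X P) (begin
      3 ≤⟨ separator-≥3 separates x∈P (outside (P⊆W x∈P)) y∉P (outside y∈W) ⟩
      ∣ Z ∣ ≤⟨ ∣p∪q∣≤∣p∣+∣q∣ Y (boundary X P) ⟩
      ∣ Y ∣ + ∣ boundary X P ∣ ≤⟨ +-mono-≤ ∣Y∣≤1 (∣boundary∣≤edges X P) ⟩
      1 + edges X P ∎)
      where
        open ≤-Reasoning
        Z : Subset n
        Z = Y ∪ boundary X P
        outside : ∀ {v} → v ∈ W → v ∉ Z
        outside v∈W v∈Z with x∈p∪q⁻ Y (boundary X P) v∈Z
        ... | inj₁ v∈Y  = ∈─⇒∉ v∈W v∈Y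
        ... | inj₂ v∈bd = ∈W⇒∉X v∈W (proj₁ (∈boundary⇒ {X} {P} v∈bd))
        separates : Separates Z P
        separates {u} {w} u∈P w∉P adj with w ∈? X | w ∈? Y
        ... | yes w∈X | _       = inj₂ (x∈p∪q⁺ (inj₂ (adj⇒∈boundary w∈X u∈P (adj-sym adj))))
        ... | no  _   | yes w∈Y = inj₂ (x∈p∪q⁺ (inj₁ w∈Y))
        ... | no  w∉X | no  w∉Y = ⊥-elim (w∉P (closed u∈P (x∈p∧x∉q⇒x∈p─q (∉⇒∈⊤─ w∉X) w∉Y) adj))

    -- The two sides of a disconnected W would each need two edges from X, but ∂(X) has only three.
    cut≤3⇒connected : cutSize G X ≤ 3 → ∣ Y ∣ ≤ 1 → ConnectedSet G W
    cut≤3⇒connected cut≤3 ∣Y∣≤1 a b a∈W b∈W = reach (b ∈? R)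
      where
        open Reachable (reachable G W a)
        R⊆W : R ⊆ W
        R⊆W u∈R = walk-stays G (walkTo u∈R) a∈W
        B : Subset n
        B = W ─ R
        B-closed : ClosedIn B
        B-closed = p─q⊆p W R , λ u∈B w∈W adj → x∈p∧x∉q⇒x∈p─q w∈W λ w∈R →
          ∈─⇒∉ u∈B (closed w∈R (w∈W , p─q⊆p W R u∈B , adj-sym adj))
        4≤sides : b ∉ R → 4 ≤ edges X R + edges X B
        4≤sides b∉R = +-mono-≤
          (closedIn-edges≥2 ∣Y∣≤1 (R⊆W , λ u∈R w∈W adj → closed u∈R (R⊆W u∈R , w∈W , adj)) a∈R b∈W b∉R)
          (closedIn-edges≥2 ∣Y∣≤1 B-closed (x∈p∧x∉q⇒x∈p─q b∈W b∉R) a∈W (λ a∈B → ∈─⇒∉ a∈B a∈R))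
        sides≤3 : edges X R + edges X B ≤ 3
        sides≤3 = begin
          edges X R + edges X B ≡⟨ edges-+ʳ X {R} {B} {W} (ind-─-split R⊆W) ⟩
          edges X W ≡⟨ edges-sym msym X W ⟩
          edges W X ≤⟨ edges-monoˡ {W} {⊤ ─ X} {X} (λ v∈W _ _ → ∉⇒∈⊤─ (∈W⇒∉X v∈W)) ⟩
          edges (⊤ ─ X) X ≡⟨ sym (cutSize≡edges-outside msym X) ⟩
          cutSize G X ≤⟨ cut≤3 ⟩
          3 ∎
          where open ≤-Reasoning
        reach : Dec (b ∈ R) → Star (StepIn G W) a b
        reach (yes b∈R) = walkTo b∈R
        reach (no  b∉R) = contradiction (≤-trans (4≤sides b∉R) sides≤3) (<-irrefl refl)

  outer-separates : ∀ K → Separates (boundary (⊤ ─ K) K) K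
  outer-separates K u∈K w∉K adj = inj₂ (adj⇒∈boundary (∉⇒∈⊤─ w∉K) u∈K (adj-sym adj))

  inner-separates : ∀ K → Separates (boundary K (⊤ ─ K)) K
  inner-separates K u∈K w∉K adj = inj₁ (adj⇒∈boundary u∈K (∉⇒∈⊤─ w∉K) adj)

  module _ {K : Subset n} {x y : Fin n} (x∈K : x ∈ K) (y∉K : y ∉ K) (y≁K : ∀ {u} → u ∈ K → ¬ Adj G u y) where

    ∣outer∣≥3 : 3 ≤ ∣ boundary (⊤ ─ K) K ∣
    ∣outer∣≥3 = separator-≥3 (outer-separates K) x∈K x∉outer y∉K y∉outer
      where
        x∉outer : x ∉ boundary (⊤ ─ K) K
        x∉outer x∈bd = ∈─⇒∉ (proj₁ (∈boundary⇒ {⊤ ─ K} {K} x∈bd)) x∈K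
        y∉outer : y ∉ boundary (⊤ ─ K) K
        y∉outer y∈bd with _ , _ , v∈K , adj ← ∈boundary⇒ {⊤ ─ K} {K} y∈bd = y≁K v∈K (adj-sym adj)

    cut≥3 : 3 ≤ cutSize G K
    cut≥3 = ≤-trans ∣outer∣≥3 (≤-trans (∣boundary∣≤edges (⊤ ─ K) K) (≤-reflexive (sym (cutSize≡edges-outside msym K))))

    cut≡3⇒matching : 3 ≤ ∣ K ∣ → cutSize G K ≡ 3 → CutIsMatching G K
    cut≡3⇒matching 3≤∣K∣ cut≡3 v with 2 ≤? cutDeg G K v
    ... | no  2≰ = ≤-pred (≰⇒> 2≰)
    ... | yes 2≤ with v ∈? K
    ...   | no  v∉K = contradiction ∣outer∣≥3 (<⇒≱ (begin-strict
      ∣ boundary (⊤ ─ K) K ∣ <⟨ ∣support∣<∑ (edgesFrom (⊤ ─ K) K) v (≤-trans 2≤ (≤-reflexive (cutDeg≡edgesFrom-out K v∉K))) ⟩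
      edges (⊤ ─ K) K ≡⟨ sym (cutSize≡edges-outside msym K) ⟩
      cutSize G K ≡⟨ cut≡3 ⟩
      3 ∎))
      where open ≤-Reasoning
    ...   | yes v∈K = separated-vertex (∣q∣<∣p∣⇒∃∈p∉q K inner (<-≤-trans ∣inner∣<3 3≤∣K∣))
      where
        open ≤-Reasoning
        inner : Subset n
        inner = boundary K (⊤ ─ K)
        ∣inner∣<3 : ∣ inner ∣ < 3
        ∣inner∣<3 = begin-strict
          ∣ inner ∣ <⟨ ∣support∣<∑ (edgesFrom K (⊤ ─ K)) v (≤-trans 2≤ (≤-reflexive (cutDeg≡edgesFrom-in K v∈K))) ⟩
          edges K (⊤ ─ K) ≡⟨ sym (cutSize≡edges K) ⟩
          cutSize G K ≡⟨ cut≡3 ⟩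
          3 ∎
        y∉inner : y ∉ inner
        y∉inner y∈bd = y∉K (proj₁ (∈boundary⇒ {K} {⊤ ─ K} y∈bd))
        separated-vertex : (∃ λ x′ → x′ ∈ K × x′ ∉ inner) → cutDeg G K v ≤ 1
        separated-vertex (x′ , x′∈K , x′∉inner) =
          contradiction (separator-≥3 (inner-separates K) x′∈K x′∉inner y∉K y∉inner) (<⇒≱ ∣inner∣<3)

  module Contraction (mloop : ∀ v → m v v ≡ 0) (m≤1 : ∀ u v → m u v ≤ 1) (cubic : ∀ v → ∑ (m v) ≡ 3)
                     (X : Subset n) (cut≡3 : cutSize G X ≡ 3) (matching : CutIsMatching G X)
                     (X≢∅ : Nonempty X) (3≤∣X̄∣ : 3 ≤ ∣ ⊤ ─ X ∣) where

    H : MGraph (suc n)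
    H = G / X

    mH : Fin (suc n) → Fin (suc n) → ℕ
    mH = MGraph.m H

    out : Fin n → Bool
    out v = lookup (⊤ ─ X) v

    out≡true : ∀ {v} → v ∉ X → out v ≡ true
    out≡true {v} v∉X = trans (lookup-⊤─ X v) (cong not (∉⇒lookup≡false v∉X))

    out≡true⇒∉ : ∀ {v} → out v ≡ true → v ∉ X
    out≡true⇒∉ {v} outv = ∈─⇒∉ (lookup⇒[]= v (⊤ ─ X) outv)

    fromX toX : Fin n → ℕ
    fromX v = ∑ λ x → if lookup X x then m x v else 0
    toX   v = ∑ λ x → if lookup X x then m v x else 0

    fromX≡toX : ∀ v → fromX v ≡ toX v
    fromX≡toX v = ∑-cong λ x → cong (λ k → if lookup X x then k else 0) (msym x v)

    toX≡cutDeg : ∀ {v} → v ∉ X → toX v ≡ cutDeg G X v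
    toX≡cutDeg {v} v∉X = ∑-cong λ u → cong (λ b → if b xor lookup X u then m v u else 0) (sym (∉⇒lookup≡false v∉X))

    toX≤1 : ∀ v → (if out v then toX v else 0) ≤ 1
    toX≤1 v with out v in outv
    ... | true  = ≤-trans (≤-reflexive (toX≡cutDeg (out≡true⇒∉ outv))) (matching v)
    ... | false = z≤n

    mH-sym : ∀ u v → mH u v ≡ mH v u
    mH-sym zero    zero    = refl
    mH-sym zero    (suc v) = cong (λ k → if out v then k else 0) (fromX≡toX v)
    mH-sym (suc u) zero    = cong (λ k → if out u then k else 0) (sym (fromX≡toX u))
    mH-sym (suc u) (suc v) = cong₂ (λ b k → if b then k else 0) (∧-comm (out u) (out v)) (msym u v)

    mH-loop : ∀ v → mH v v ≡ 0
    mH-loop zero    = refl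
    mH-loop (suc v) = trans (cong (λ k → if out v ∧ out v then k else 0) (mloop v)) (if-eta (out v ∧ out v))

    mH-in-V : ∀ u v → 0 < mH u v → u ∈ V H × v ∈ V H
    mH-in-V zero    (suc v) 0<m with true ← out v in outv = here , there (lookup⇒[]= v (⊤ ─ X) outv)
    mH-in-V (suc u) zero    0<m with true ← out u in outu = there (lookup⇒[]= u (⊤ ─ X) outu) , here
    mH-in-V (suc u) (suc v) 0<m with true ← out u in outu | true ← out v in outv =
      there (lookup⇒[]= u (⊤ ─ X) outu) , there (lookup⇒[]= v (⊤ ─ X) outv)

    mH≤1 : ∀ u v → mH u v ≤ 1
    mH≤1 zero    zero    = z≤n
    mH≤1 zero    (suc v) = subst (_≤ 1) (mH-sym (suc v) zero) (toX≤1 v)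
    mH≤1 (suc u) zero    = toX≤1 u
    mH≤1 (suc u) (suc v) with out u ∧ out v
    ... | true  = m≤1 u v
    ... | false = z≤n

    simple : Simple H
    simple = (mH-sym , mH-loop , mH-in-V) , mH≤1

    deg-contracted : deg H zero ≡ 3
    deg-contracted = begin
      ∑ (λ v → if out v then fromX v else 0) ≡⟨ ∑-cong pointwise ⟩
      edges (⊤ ─ X) X ≡⟨ sym (cutSize≡edges-outside msym X) ⟩
      cutSize G X ≡⟨ cut≡3 ⟩
      3 ∎
      where
        open ≡-Reasoning
        pointwise : ∀ v → (if out v then fromX v else 0) ≡ edgesFrom (⊤ ─ X) X v
        pointwise v with out v
        ... | false = sym (∑-zero {n})
        ... | true  = ∑-cong λ x → term≡ (lookup X x) (msym x v)
          where
            term≡ : ∀ b {k k′} → k ≡ k′ → (if b then k else 0) ≡ 1 * ind b * k′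
            term≡ true  k≡k′ = trans k≡k′ (sym (+-identityʳ _))
            term≡ false _    = refl

    deg-uncontracted : ∀ v → out v ≡ true → deg H (suc v) ≡ 3
    deg-uncontracted v outv rewrite outv = begin
      toX v + ∑ (λ u → if out u then m v u else 0) ≡⟨ sym (∑-+ (λ u → if lookup X u then m v u else 0) _) ⟩
      ∑ (λ u → (if lookup X u then m v u else 0) + (if out u then m v u else 0)) ≡⟨ ∑-cong split ⟩
      ∑ (m v) ≡⟨ cubic v ⟩
      3 ∎
      where
        open ≡-Reasoning
        split : ∀ u → (if lookup X u then m v u else 0) + (if out u then m v u else 0) ≡ m v u
        split u rewrite lookup-⊤─ X u with lookup X u
        ... | true  = +-identityʳ (m v u)
        ... | false = refl

    cubicH : Cubic H
    cubicH zero    _           = deg-contracted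
    cubicH (suc v) (there v∈V) = deg-uncontracted v ([]=⇒lookup v∈V)

    adj-from-X : ∀ {x v} → x ∈ X → v ∉ X → Adj G x v → 0 < mH zero (suc v)
    adj-from-X {x} {v} x∈X v∉X adj rewrite out≡true v∉X =
      <-≤-trans adj (≤-trans (≤-reflexive (cong (λ b → if b then m x v else 0) (sym ([]=⇒lookup x∈X))))
                             (f≤∑f (λ x′ → if lookup X x′ then m x′ v else 0) x))

    adj-to-X : ∀ {u x} → u ∉ X → x ∈ X → Adj G u x → 0 < mH (suc u) zero
    adj-to-X u∉X x∈X adj = subst (0 <_) (mH-sym zero (suc _)) (adj-from-X x∈X u∉X (adj-sym adj))

    adj-outside : ∀ {u v} → u ∉ X → v ∉ X → Adj G u v → 0 < mH (suc u) (suc v)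
    adj-outside u∉X v∉X adj rewrite out≡true u∉X | out≡true v∉X = adj

    ∉∉⇒∈W : ∀ {Y v} → v ∉ X → v ∉ Y → v ∈ ⊤ ─ X ─ Y
    ∉∉⇒∈W v∉X v∉Y = x∈p∧x∉q⇒x∈p─q (∉⇒∈⊤─ v∉X) v∉Y

    connected-without-contracted : ∀ Y → ∣ Y ∣ ≤ 1 → ConnectedOn H (false ∷ (⊤ ─ X ─ Y))
    connected-without-contracted Y ∣Y∣≤1 = nonempty (∣q∣<∣p∣⇒∃∈p∉q (⊤ ─ X) Y (≤-trans (s≤s ∣Y∣≤1) (≤-trans (s≤s (s≤s z≤n)) 3≤∣X̄∣))) , connected
      where
        nonempty : (∃ λ v → v ∈ ⊤ ─ X × v ∉ Y) → Nonempty (false ∷ (⊤ ─ X ─ Y))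
        nonempty (v , v∈X̄ , v∉Y) = suc v , there (x∈p∧x∉q⇒x∈p─q v∈X̄ v∉Y)
        lift : ∀ {u w} → StepIn G (⊤ ─ X ─ Y) u w → StepIn H (false ∷ (⊤ ─ X ─ Y)) (suc u) (suc w)
        lift (u∈W , w∈W , adj) = there u∈W , there w∈W , adj-outside (∈W⇒∉X X Y u∈W) (∈W⇒∉X X Y w∈W) adj
        connected : ConnectedSet H (false ∷ (⊤ ─ X ─ Y))
        connected (suc u) (suc w) (there u∈W) (there w∈W) =
          gmap suc lift (cut≤3⇒connected X Y (≤-reflexive cut≡3) ∣Y∣≤1 u w u∈W w∈W)

    shrink : Fin n → Fin (suc n)
    shrink v = if lookup X v then zero else suc v

    connected-with-contracted : ∀ Y → (∀ {y} → y ∈ Y → y ∉ X) → ∣ Y ∣ < 3 → ConnectedOn H (true ∷ (⊤ ─ X ─ Y))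
    connected-with-contracted Y Y∩X≡∅ ∣Y∣<3 = (zero , here) , connected
      where
        W′ : Subset (suc n)
        W′ = true ∷ (⊤ ─ X ─ Y)
        shrink-step : ∀ {u w} → StepIn G (⊤ ─ Y) u w → Star (StepIn H W′) (shrink u) (shrink w)
        shrink-step {u} {w} (u∈Ȳ , w∈Ȳ , adj) with lookup X u in Xu | lookup X w in Xw
        ... | true  | true  = ε
        ... | true  | false = (here , there (∉∉⇒∈W w∉X (∈─⇒∉ w∈Ȳ)) , adj-from-X (lookup⇒[]= u X Xu) w∉X adj) ◅ ε
          where w∉X = lookup≡false⇒∉ Xw
        ... | false | true  = (there (∉∉⇒∈W u∉X (∈─⇒∉ u∈Ȳ)) , here , adj-to-X u∉X (lookup⇒[]= w X Xw) adj) ◅ ε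
          where u∉X = lookup≡false⇒∉ Xu
        ... | false | false = (there (∉∉⇒∈W u∉X (∈─⇒∉ u∈Ȳ)) , there (∉∉⇒∈W w∉X (∈─⇒∉ w∈Ȳ)) , adj-outside u∉X w∉X adj) ◅ ε
          where u∉X = lookup≡false⇒∉ Xu
                w∉X = lookup≡false⇒∉ Xw
        shrink-walk : ∀ {u w} → Star (StepIn G (⊤ ─ Y)) u w → Star (StepIn H W′) (shrink u) (shrink w)
        shrink-walk ε             = ε
        shrink-walk (step ◅ walk) = shrink-step step ◅◅ shrink-walk walk
        preimage : ∀ p → p ∈ W′ → ∃ λ v → v ∉ Y × shrink v ≡ p
        preimage zero _ = let x , x∈X = X≢∅ in
          x , (λ x∈Y → Y∩X≡∅ x∈Y x∈X) , cong (λ b → if b then zero else suc x) ([]=⇒lookup x∈X)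
        preimage (suc v) (there v∈W) =
          v , ∈─⇒∉ v∈W , cong (λ b → if b then zero else suc v) (∉⇒lookup≡false (∈W⇒∉X X Y v∈W))
        connected : ConnectedSet H W′
        connected p q p∈W′ q∈W′ with u , u∉Y , u↦p ← preimage p p∈W′ | w , w∉Y , w↦q ← preimage q q∈W′ =
          subst₂ (Star (StepIn H W′)) u↦p w↦q (shrink-walk (proj₂ (conn Y ∣Y∣<3) u w (∉⇒∈⊤─ u∉Y) (∉⇒∈⊤─ w∉Y)))

    connectedH : ∀ X′ → X′ ⊆ V H → ∣ X′ ∣ < 3 → ConnectedOn H (V H ─ X′)
    connectedH (true  ∷ Y) _     ∣X′∣<3 = connected-without-contracted Y (≤-pred (≤-pred ∣X′∣<3))
    connectedH (false ∷ Y) X′⊆V ∣X′∣<3 =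
      connected-with-contracted Y (λ y∈Y → ∈─⇒∉ (drop-there (X′⊆V (there y∈Y)))) ∣X′∣<3

    contraction-3-connected-simple-cubic : ThreeConnectedSimpleCubic H
    contraction-3-connected-simple-cubic = (s≤s 3≤∣X̄∣ , connectedH) , simple , cubicH

m*3≢1+n*3 : ∀ a b → a * 3 ≢ suc (b * 3)
m*3≢1+n*3 zero    b       ()
m*3≢1+n*3 (suc a) zero    ()
m*3≢1+n*3 (suc a) (suc b) e = m*3≢1+n*3 a b (suc-injective (suc-injective (suc-injective e)))

one-side-zero-mod-3 : ∀ {a b i} x y → a * 3 ≡ i + x → b * 3 ≡ i + y → x + y ≡ 3 → x ≡ 0 ⊎ y ≡ 0
one-side-zero-mod-3                 0 _ _  _  _    = inj₁ refl
one-side-zero-mod-3 {a} {b} {i}     1 y a3 b3 x+y≡3 with refl ← x+y≡3 =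
  ⊥-elim (m*3≢1+n*3 b a (trans b3 (trans (+-suc i 1) (cong suc (sym a3)))))
one-side-zero-mod-3 {a} {b} {i}     2 y a3 b3 x+y≡3 with refl ← x+y≡3 =
  ⊥-elim (m*3≢1+n*3 a b (trans a3 (trans (+-suc i 1) (cong suc (sym b3)))))
one-side-zero-mod-3                 3 y _  _  x+y≡3 with refl ← x+y≡3 = inj₂ refl
one-side-zero-mod-3 (suc (suc (suc (suc x)))) y _ _ ()

module BipartiteCut {n} (m : Fin n → Fin n → ℕ) (msym : ∀ u v → m u v ≡ m v u) (cubic : ∀ v → ∑ (m v) ≡ 3) where

  open Edges m

  AttachedColouring : Subset n → Set
  AttachedColouring K = Σ (Fin n → Bool) λ c →
    (∀ u v → u ∈ K → v ∈ K → Adj G u v → c u ≢ c v) × (∀ u w → u ∈ K → w ∉ K → Adj G u w → c u ≡ true)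

  module _ (K : Subset n) (c : Fin n → Bool) (proper : ∀ u v → u ∈ K → v ∈ K → Adj G u v → c u ≢ c v) where

    A B : Subset n
    A = tabulate (λ v → lookup K v ∧ c v)
    B = K ─ A

    lookup-A : ∀ v → lookup A v ≡ lookup K v ∧ c v
    lookup-A = lookup∘tabulate (λ v → lookup K v ∧ c v)

    ∈A : ∀ {u} → u ∈ K → c u ≡ true → u ∈ A
    ∈A {u} u∈K cu = lookup⇒[]= u A (trans (lookup-A u) (cong₂ _∧_ ([]=⇒lookup u∈K) cu))

    ∈A⇒ : ∀ {u} → u ∈ A → c u ≡ true
    ∈A⇒ {u} u∈A with lookup K u | c u | trans (sym (lookup-A u)) ([]=⇒lookup u∈A)
    ... | true | true | _ = refl

    A⊆K : A ⊆ K
    A⊆K {u} u∈A with lookup K u in Ku | trans (sym (lookup-A u)) ([]=⇒lookup u∈A)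
    ... | true | _ = lookup⇒[]= u K Ku

    ∈B : ∀ {u} → u ∈ K → c u ≡ false → u ∈ B
    ∈B u∈K cu≡false = x∈p∧x∉q⇒x∈p─q u∈K λ u∈A → true≢false (trans (sym (∈A⇒ u∈A)) cu≡false)

    lookup-B : ∀ v → lookup B v ≡ lookup K v ∧ not (c v)
    lookup-B v rewrite lookup-─ K A v | lookup-A v with lookup K v
    ... | true  = refl
    ... | false = refl

    ∈B⇒ : ∀ {u} → u ∈ B → c u ≡ false
    ∈B⇒ {u} u∈B with lookup K u | c u | trans (sym (lookup-B u)) ([]=⇒lookup u∈B)
    ... | true | false | _ = refl

    neighbour-colour : ∀ {u v} → u ∈ K → Adj G u v → lookup K v ≡ true → c v ≡ not (c u)
    neighbour-colour {u} {v} u∈K adj Kv with c u | c v | proper u v u∈K (lookup⇒[]= v K Kv) adj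
    ... | true  | false | _     = refl
    ... | false | true  | _     = refl
    ... | true  | true  | cu≢cv = ⊥-elim (cu≢cv refl)
    ... | false | false | cu≢cv = ⊥-elim (cu≢cv refl)

    edges-A-K : edges A K ≡ edges A B
    edges-A-K = edges-congʳ {A} {K} {B} K≡B
      where
        K≡B : ∀ {u v} → u ∈ A → Adj G u v → lookup K v ≡ lookup B v
        K≡B {u} {v} u∈A adj rewrite lookup-B v with lookup K v in Kv
        ... | false = refl
        ... | true rewrite neighbour-colour (A⊆K u∈A) adj Kv | ∈A⇒ u∈A = refl

    edges-B-K : edges B K ≡ edges B A
    edges-B-K = edges-congʳ {B} {K} {A} K≡A
      where
        K≡A : ∀ {u v} → u ∈ B → Adj G u v → lookup K v ≡ lookup A v
        K≡A {u} {v} u∈B adj rewrite lookup-A v with lookup K v in Kv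
        ... | false = refl
        ... | true rewrite neighbour-colour (p─q⊆p K A u∈B) adj Kv | ∈B⇒ u∈B = refl

    -- 3∣A∣ = e(A,K) + e(A,K̄) and 3∣B∣ = e(B,K) + e(B,K̄) with e(A,K) = e(B,K), while e(A,K̄) + e(B,K̄) = 3;
    -- so 3 divides e(A,K̄) − e(B,K̄), which forces one of them to vanish.
    attached-side : cutSize G K ≡ 3 → edges A (⊤ ─ K) ≡ 0 ⊎ edges B (⊤ ─ K) ≡ 0
    attached-side cut≡3 = one-side-zero-mod-3 {∣ A ∣} {∣ B ∣} {edges A K} (edges A (⊤ ─ K)) (edges B (⊤ ─ K)) (3∣X∣ A) 3∣B∣ cut-split
      where
        3∣X∣ : ∀ X → ∣ X ∣ * 3 ≡ edges X K + edges X (⊤ ─ K)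
        3∣X∣ X = sym (trans (edges-+ʳ X {K} {⊤ ─ K} {⊤} (ind-─-split (λ _ → ∈⊤))) (edges-⊤ cubic X))
        3∣B∣ : ∣ B ∣ * 3 ≡ edges A K + edges B (⊤ ─ K)
        3∣B∣ = trans (3∣X∣ B) (cong (_+ edges B (⊤ ─ K))
                 (trans edges-B-K (trans (edges-sym msym B A) (sym edges-A-K))))
        cut-split : edges A (⊤ ─ K) + edges B (⊤ ─ K) ≡ 3
        cut-split = trans (edges-+ˡ {A} {B} {K} (⊤ ─ K) (ind-─-split A⊆K)) (trans (sym (cutSize≡edges K)) cut≡3)

    silent-colour : ∀ {X} → edges X (⊤ ─ K) ≡ 0 → ∀ {u w} → u ∈ X → w ∉ K → ¬ Adj G u w
    silent-colour X-silent u∈X w∉K adj = <⇒≢ (adj⇒0<edges u∈X (∉⇒∈⊤─ w∉K) adj) (sym X-silent)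

  bipartite-cut≡3⇒attached : ∀ K → cutSize G K ≡ 3 → BipartiteOn G K → AttachedColouring K
  bipartite-cut≡3⇒attached K cut≡3 (c , proper) with attached-side K c proper cut≡3
  ... | inj₁ A-silent = not ∘ c , (λ u v u∈K v∈K adj → proper u v u∈K v∈K adj ∘ not-injective) , attach
    where
      attach : ∀ u w → u ∈ K → w ∉ K → Adj G u w → not (c u) ≡ true
      attach u w u∈K w∉K adj with c u in cu
      ... | false = refl
      ... | true  = ⊥-elim (silent-colour K c proper A-silent (∈A K c proper u∈K cu) w∉K adj)
  ... | inj₂ B-silent = c , proper , attach
    where
      attach : ∀ u w → u ∈ K → w ∉ K → Adj G u w → c u ≡ true
      attach u w u∈K w∉K adj with c u in cu
      ... | true  = refl
      ... | false = ⊥-elim (silent-colour K c proper B-silent (∈B K c proper u∈K cu) w∉K adj)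

distinct-pair : ∀ {k} → 2 ≤ k → Σ (Fin k) λ i → Σ (Fin k) λ j → i ≢ j
distinct-pair {suc (suc k)} _ = zero , suc zero , λ ()
distinct-pair {suc zero} (s≤s ())

odd-≥2⇒≥3 : ∀ {k} → Odd k → 2 ≤ k → 3 ≤ k
odd-≥2⇒≥3 (zero  , refl) (s≤s ())
odd-≥2⇒≥3 (suc j , refl) _ = s≤s (s≤s (≤-trans (s≤s z≤n) (m≤n+m _ j)))

module Barrier {n} (m : Fin n → Fin n → ℕ)
               (msym : ∀ u v → m u v ≡ m v u) (mloop : ∀ v → m v v ≡ 0) (m≤1 : ∀ u v → m u v ≤ 1)
               (cubic : ∀ v → ∑ (m v) ≡ 3) (conn : ∀ X → ∣ X ∣ < 3 → ConnectedOn (mgraph ⊤ m) (⊤ ─ X))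
               (S : Subset n) (K : Fin ∣ S ∣ → Subset n)
               (K-odd-component : ∀ i → IsComponent (mgraph ⊤ m) S (K i) × Odd ∣ K i ∣)
               (K-injective : ∀ i j → K i ≡ K j → i ≡ j) (2≤∣S∣ : 2 ≤ ∣ S ∣) where

  open Edges m
  open ThreeConnected m msym conn
  open BipartiteCut m msym cubic

  Component : Subset n → Set
  Component = IsComponent G S

  K-component : ∀ i → Component (K i)
  K-component i = proj₁ (K-odd-component i)

  ∈component⇒∉S : ∀ {L v} → Component L → v ∈ L → v ∉ S
  ∈component⇒∉S (L⊆V─S , _) v∈L = ∈─⇒∉ (L⊆V─S v∈L)

  adj-component : ∀ {L u v} → Component L → u ∈ L → v ∉ S → Adj G u v → v ∈ L
  adj-component (_ , _ , _ , closed) u∈L v∉S adj = closed _ _ u∈L ∈⊤ v∉S adj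

  another-component : ∀ L → ∃ λ i → K i ≢ L
  another-component L with i , j , i≢j ← distinct-pair 2≤∣S∣ with ≡-dec _≟ᵇ_ (K i) L
  ... | no  Ki≢L = i , Ki≢L
  ... | yes Ki≡L = j , λ Kj≡L → i≢j (K-injective i j (trans Ki≡L (sym Kj≡L)))

  outside-vertex : ∀ {L} → Component L → ∃ λ y → y ∉ L × y ∉ S
  outside-vertex {L} cL with i , Ki≢L ← another-component L
                         with cKi@(_ , (y , y∈Ki) , _) ← K-component i =
    y , (λ y∈L → Ki≢L (component-≡ cKi cL y∈Ki y∈L)) , ∈component⇒∉S cKi y∈Ki

  nonadjacent : ∀ {L y} → Component L → y ∉ L → y ∉ S → ∀ {u} → u ∈ L → ¬ Adj G u y
  nonadjacent cL y∉L y∉S u∈L adj = y∉L (adj-component cL u∈L y∉S adj)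

  component-cut≥3 : ∀ {L} → Component L → 3 ≤ cutSize G L
  component-cut≥3 cL@(_ , (x , x∈L) , _) with y , y∉L , y∉S ← outside-vertex cL =
    cut≥3 x∈L y∉L (nonadjacent cL y∉L y∉S)

  cutSize≤edges-from-S : ∀ {L} → Component L → cutSize G L ≤ edges S L
  cutSize≤edges-from-S {L} cL = ≤-trans (≤-reflexive (cutSize≡edges-outside msym L)) (edges-monoˡ {⊤ ─ L} {S} {L} in-S)
    where
      in-S : ∀ {u v} → u ∈ ⊤ ─ L → v ∈ L → Adj G u v → u ∈ S
      in-S {u} u∈L̄ v∈L adj = decidable-stable (u ∈? S) λ u∉S → ∈─⇒∉ u∈L̄ (adj-component cL v∈L u∉S (adj-sym adj))

  -- Every edge leaving a component ends in S, and each vertex of S has degree 3.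
  disjoint-components-bound : ∀ {j} (F : Fin j → Subset n) → (∀ i → Component (F i)) → (∀ i i′ → F i ≡ F i′ → i ≡ i′) →
                              ∑ (λ i → cutSize G (F i)) + edges S S ≤ ∣ S ∣ * 3
  disjoint-components-bound {j} F cF F-injective = begin
    ∑ (λ i → cutSize G (F i)) + edges S S ≤⟨ +-monoˡ-≤ (edges S S) (∑-mono-≤ (λ i → cutSize≤edges-from-S (cF i))) ⟩
    ∑ (λ i → edges S (F i)) + edges S S ≡⟨ +-comm _ (edges S S) ⟩
    ∑ (λ i → edges S ((S ∷ᶠ F) i)) ≤⟨ ∑edges≤ S (S ∷ᶠ F) ⊤ disjoint ⟩
    edges S ⊤ ≡⟨ edges-⊤ cubic S ⟩
    ∣ S ∣ * 3 ∎
    where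
      open ≤-Reasoning
      unique : ∀ v i i′ → lookup ((S ∷ᶠ F) i) v ≡ true → lookup ((S ∷ᶠ F) i′) v ≡ true → i ≡ i′
      unique v zero     zero     _ _ = refl
      unique v zero     (suc i′) v∈S v∈F = ⊥-elim (∈component⇒∉S (cF i′) (lookup⇒[]= v _ v∈F) (lookup⇒[]= v S v∈S))
      unique v (suc i)  zero     v∈F v∈S = ⊥-elim (∈component⇒∉S (cF i) (lookup⇒[]= v _ v∈F) (lookup⇒[]= v S v∈S))
      unique v (suc i)  (suc i′) v∈F v∈F′ =
        cong suc (F-injective i i′ (component-≡ (cF i) (cF i′) (lookup⇒[]= v _ v∈F) (lookup⇒[]= v _ v∈F′)))
      disjoint : ∀ v → ∑ (λ i → ind (lookup ((S ∷ᶠ F) i) v)) ≤ ind (lookup ⊤ v)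
      disjoint v = subst (λ b → ∑ (λ i → ind (lookup ((S ∷ᶠ F) i) v)) ≤ ind b) (sym (lookup-replicate v true))
                         (∑-ind≤1 (λ i → lookup ((S ∷ᶠ F) i) v) (unique v))

  K-cut≥3 : ∀ i → 3 ≤ cutSize G (K i)
  K-cut≥3 i = component-cut≥3 (K-component i)

  K-bound : ∑ (λ i → cutSize G (K i)) + edges S S ≤ ∣ S ∣ * 3
  K-bound = disjoint-components-bound K K-component K-injective

  -- An unlisted component would give ∣S∣ + 1 disjoint components, each with at least three edges into S.
  K-listed : ∀ {L} → Component L → ∃ λ i → K i ≡ L
  K-listed {L} cL with any? (λ i → ≡-dec _≟ᵇ_ (K i) L)
  ... | yes found = found
  ... | no  none  = contradiction (≤-trans (m≤m+n _ (edges S S)) (disjoint-components-bound (L ∷ᶠ K) cF F-injective)) (<⇒≱ (begin-strict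
    ∣ S ∣ * 3 <⟨ m<n+m (∣ S ∣ * 3) {3} (s≤s z≤n) ⟩
    suc ∣ S ∣ * 3 ≤⟨ n*a≤∑ 3 (λ i → cutSize G ((L ∷ᶠ K) i)) (λ i → component-cut≥3 (cF i)) ⟩
    ∑ (λ i → cutSize G ((L ∷ᶠ K) i)) ∎))
    where
      open ≤-Reasoning
      cF : ∀ i → Component ((L ∷ᶠ K) i)
      cF zero    = cL
      cF (suc i) = K-component i
      F-injective : ∀ i i′ → (L ∷ᶠ K) i ≡ (L ∷ᶠ K) i′ → i ≡ i′
      F-injective zero    zero     _ = refl
      F-injective zero    (suc i′) L≡K = ⊥-elim (none (i′ , sym L≡K))
      F-injective (suc i) zero     K≡L = ⊥-elim (none (i , K≡L))
      F-injective (suc i) (suc i′) K≡K = cong suc (K-injective i i′ K≡K)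

  K-cut≡3 : ∀ i → cutSize G (K i) ≡ 3
  K-cut≡3 = ∑≤n*a⇒≡a 3 (λ i → cutSize G (K i)) K-cut≥3 (≤-trans (m≤m+n _ (edges S S)) K-bound)

  S-independent : edges S S ≡ 0
  S-independent = n≤0⇒n≡0 (+-cancelˡ-≤ (∑ (λ i → cutSize G (K i))) (edges S S) 0 (begin
    ∑ (λ i → cutSize G (K i)) + edges S S ≤⟨ K-bound ⟩
    ∣ S ∣ * 3 ≤⟨ n*a≤∑ 3 (λ i → cutSize G (K i)) K-cut≥3 ⟩
    ∑ (λ i → cutSize G (K i)) ≡⟨ sym (+-identityʳ _) ⟩
    ∑ (λ i → cutSize G (K i)) + 0 ∎))
    where open ≤-Reasoning

  component-odd : ∀ {L} → Component L → Odd ∣ L ∣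
  component-odd cL with i , refl ← K-listed cL = proj₂ (K-odd-component i)

  component-cut≡3 : ∀ {L} → Component L → cutSize G L ≡ 3
  component-cut≡3 cL with i , refl ← K-listed cL = K-cut≡3 i

  component-matching : ∀ {L} → Component L → 2 ≤ ∣ L ∣ → CutIsMatching G L
  component-matching cL@(_ , (x , x∈L) , _) 2≤∣L∣ with y , y∉L , y∉S ← outside-vertex cL =
    cut≡3⇒matching x∈L y∉L (nonadjacent cL y∉L y∉S) (odd-≥2⇒≥3 (component-odd cL) 2≤∣L∣) (component-cut≡3 cL)

  module Tightness (p : Fin n → Fin n) (perfect : ∀ v → v ∈ ⊤ → Adj G v (p v) × p (p v) ≡ v) where

    p-adj : ∀ v → Adj G v (p v)
    p-adj v = proj₁ (perfect v ∈⊤)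

    p∘p : ∀ v → p (p v) ≡ v
    p∘p v = proj₂ (perfect v ∈⊤)

    p≢id : ∀ v → p v ≢ v
    p≢id v pv≡v = <⇒≢ (subst (Adj G v) pv≡v (p-adj v)) (sym (mloop v))

    matchCut≤ : ∀ {L} → Component L → matchCut G L p ≤ ∑ (λ v → ind (lookup L v) * ind (lookup S (p v)))
    matchCut≤ {L} cL = ∑-mono-≤ pointwise
      where
        pointwise : ∀ v → (if lookup ⊤ v ∧ lookup L v ∧ not (lookup L (p v)) then 1 else 0) ≤ ind (lookup L v) * ind (lookup S (p v))
        pointwise v rewrite lookup-replicate v true with lookup L v in Lv | lookup L (p v) in Lpv
        ... | false | _     = z≤n
        ... | true  | true  = z≤n
        ... | true  | false = ≤-reflexive (sym (trans (*-identityˡ _) (cong ind ([]=⇒lookup (partner-in-S Lv Lpv)))))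
          where
            partner-in-S : ∀ {v} → lookup L v ≡ true → lookup L (p v) ≡ false → p v ∈ S
            partner-in-S {v} Lv Lpv = decidable-stable (p v ∈? S) λ pv∉S →
              lookup≡false⇒∉ Lpv (adj-component cL (lookup⇒[]= v L Lv) pv∉S (p-adj v))

    ∑matchCut≤∣S∣ : ∑ (λ i → matchCut G (K i) p) ≤ ∣ S ∣ * 1
    ∑matchCut≤∣S∣ = begin
      ∑ (λ i → matchCut G (K i) p) ≤⟨ ∑-mono-≤ (λ i → matchCut≤ (K-component i)) ⟩
      ∑ (λ i → ∑ λ v → ind (lookup (K i) v) * ind (lookup S (p v))) ≡⟨ ∑-swap (λ i v → ind (lookup (K i) v) * ind (lookup S (p v))) ⟩
      ∑ (λ v → ∑ λ i → ind (lookup (K i) v) * ind (lookup S (p v))) ≡⟨ ∑-cong (λ v → sym (*-distribʳ-∑ _ (λ i → ind (lookup (K i) v)))) ⟩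
      ∑ (λ v → ∑ (λ i → ind (lookup (K i) v)) * ind (lookup S (p v))) ≤⟨ ∑-mono-≤ (λ v → *-monoˡ-≤ _ (∑-ind≤1 _ (unique v))) ⟩
      ∑ (λ v → 1 * ind (lookup S (p v))) ≡⟨ ∑-cong (λ v → *-identityˡ (ind (lookup S (p v)))) ⟩
      ∑ (ind ∘ lookup S ∘ p) ≡⟨ ∑-involution p p∘p (ind ∘ lookup S) ⟩
      ∑ (ind ∘ lookup S) ≡⟨ sym (∣p∣≡∑ind S) ⟩
      ∣ S ∣ ≡⟨ sym (*-identityʳ _) ⟩
      ∣ S ∣ * 1 ∎
      where
        open ≤-Reasoning
        unique : ∀ v i j → lookup (K i) v ≡ true → lookup (K j) v ≡ true → i ≡ j
        unique v i j v∈Ki v∈Kj =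
          K-injective i j (component-≡ (K-component i) (K-component j) (lookup⇒[]= v (K i) v∈Ki) (lookup⇒[]= v (K j) v∈Kj))

    matchCut≡0⇒closed : ∀ {L} → matchCut G L p ≡ 0 → ∀ {v} → lookup L v ≡ true → lookup L (p v) ≡ true
    matchCut≡0⇒closed {L} mc≡0 {v} Lv with lookup L (p v) in Lpv
    ... | true  = refl
    ... | false = contradiction (≤-trans (≤-reflexive (sym term≡1)) (≤-trans (f≤∑f _ v) (≤-reflexive mc≡0))) (λ ())
      where
        term≡1 : (if lookup ⊤ v ∧ lookup L v ∧ not (lookup L (p v)) then 1 else 0) ≡ 1
        term≡1 rewrite lookup-replicate v true | Lv | Lpv = refl

    matchCut≡0⇒invariant : ∀ {L} → matchCut G L p ≡ 0 → ∀ v → lookup L (p v) ≡ lookup L v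
    matchCut≡0⇒invariant {L} mc≡0 v with lookup L v in Lv
    ... | true  = matchCut≡0⇒closed {L} mc≡0 Lv
    ... | false with lookup L (p v) in Lpv
    ...   | false = refl
    ...   | true  = ⊥-elim (true≢false (trans (sym (matchCut≡0⇒closed {L} mc≡0 Lpv)) (trans (cong (lookup L) (p∘p v)) Lv)))

    matchCut≥1 : ∀ {L} → Component L → 1 ≤ matchCut G L p
    matchCut≥1 {L} cL with matchCut G L p in mc
    ... | suc _ = s≤s z≤n
    ... | zero with half , ∣L∣≡half+half ← involution-invariant⇒even p p∘p p≢id L (matchCut≡0⇒invariant {L} mc)
                with j , ∣L∣≡odd ← component-odd cL =
      ⊥-elim (even≢odd half j (trans (cong (half +_) (+-identityʳ half)) (trans (sym ∣L∣≡half+half) ∣L∣≡odd)))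

    K-matchCut≡1 : ∀ i → matchCut G (K i) p ≡ 1
    K-matchCut≡1 = ∑≤n*a⇒≡a 1 (λ i → matchCut G (K i) p) (λ i → matchCut≥1 (K-component i)) ∑matchCut≤∣S∣

  component-tight : ∀ {L} → Component L → Tight G L
  component-tight cL (p , perfect) with i , refl ← K-listed cL = Tightness.K-matchCut≡1 p perfect i

  component-contractions : ∀ {L} → Component L → 2 ≤ ∣ L ∣ →
                           ThreeConnectedSimpleCubic (G / L) × ThreeConnectedSimpleCubic (G / (⊤ ─ L))
  component-contractions {L} cL@(_ , L≢∅ , _) 2≤∣L∣ with y , y∉L , y∉S ← outside-vertex cL =
    Contraction.contraction-3-connected-simple-cubic mloop m≤1 cubic L
      (component-cut≡3 cL) (component-matching cL 2≤∣L∣) L≢∅ 3≤∣L̄∣ ,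
    Contraction.contraction-3-connected-simple-cubic mloop m≤1 cubic (⊤ ─ L)
      cutL̄≡3 (λ v → subst (_≤ 1) (sym (cutDeg-complement L v)) (component-matching cL 2≤∣L∣ v))
      (y , ∉⇒∈⊤─ y∉L) (subst (λ X → 3 ≤ ∣ X ∣) (sym (⊤─⊤─p≡p L)) (odd-≥2⇒≥3 (component-odd cL) 2≤∣L∣))
    where
      S⊂L̄ : S ⊂ ⊤ ─ L
      S⊂L̄ = (λ v∈S → ∉⇒∈⊤─ λ v∈L → ∈component⇒∉S cL v∈L v∈S) , y , ∉⇒∈⊤─ y∉L , y∉S
      3≤∣L̄∣ : 3 ≤ ∣ ⊤ ─ L ∣
      3≤∣L̄∣ = ≤-trans (s≤s 2≤∣S∣) (p⊂q⇒∣p∣<∣q∣ S⊂L̄)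
      cutL̄≡3 : cutSize G (⊤ ─ L) ≡ 3
      cutL̄≡3 = begin
        cutSize G (⊤ ─ L) ≡⟨ cutSize≡edges (⊤ ─ L) ⟩
        edges (⊤ ─ L) (⊤ ─ (⊤ ─ L)) ≡⟨ cong (edges (⊤ ─ L)) (⊤─⊤─p≡p L) ⟩
        edges (⊤ ─ L) L ≡⟨ sym (cutSize≡edges-outside msym L) ⟩
        cutSize G L ≡⟨ component-cut≡3 cL ⟩
        3 ∎
        where open ≡-Reasoning

  bipartiteOn? : ∀ L → Dec (BipartiteOn G L)
  bipartiteOn? L = map′ (λ (C , proper) → lookup C , proper) fromColouring
    (anySubset? λ C → all? λ u → all? λ v →
      (u ∈? L) →-dec (v ∈? L) →-dec (0 <? m u v) →-dec ¬? (lookup C u ≟ᵇ lookup C v))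
    where
      fromColouring : BipartiteOn G L → ∃ λ C → ∀ u v → u ∈ L → v ∈ L → Adj G u v → lookup C u ≢ lookup C v
      fromColouring (c , proper) = tabulate c , λ u v u∈L v∈L adj →
        proper u v u∈L v∈L adj ∘ subst₂ _≡_ (lookup∘tabulate c u) (lookup∘tabulate c v)

  component-colouring : ∀ i → ¬ (2 ≤ ∣ K i ∣ × ¬ BipartiteOn G (K i)) → AttachedColouring (K i)
  component-colouring i not-counterexample with 2 ≤? ∣ K i ∣
  ... | yes 2≤ with bipartiteOn? (K i)
  ...   | yes bipartite = bipartite-cut≡3⇒attached (K i) (K-cut≡3 i) bipartite
  ...   | no  nonbipartite = ⊥-elim (not-counterexample (2≤ , nonbipartite))
  component-colouring i not-counterexample | no 2≰ = (λ _ → true) , no-inner-edge , λ _ _ _ _ _ → refl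
    where
      no-inner-edge : ∀ u v → u ∈ K i → v ∈ K i → Adj G u v → true ≢ true
      no-inner-edge u v u∈K v∈K adj _ =
        <⇒≢ (subst (Adj G u) (sym (∣p∣≤1⇒≡ (K i) (≤-pred (≰⇒> 2≰)) u∈K v∈K)) adj) (sym (mloop u))

  -- S gets colour false (its vertices lie in no K i); the ends in K i of the cut edges have colour true.
  module Colouring (colouring : ∀ i → AttachedColouring (K i)) where

    colourVia : ∀ v → Dec (∃ λ i → v ∈ K i) → Bool
    colourVia v (yes (i , _)) = proj₁ (colouring i) v
    colourVia v (no _)        = false

    colour : Fin n → Bool
    colour v = colourVia v (any? λ i → v ∈? K i)

    in-some-K : ∀ {v} → v ∉ S → ∃ λ i → v ∈ K i
    in-some-K v∉S with L , cL , v∈L ← componentOf {G = G} {S = S} msym ∈⊤ v∉S with i , refl ← K-listed cL = i , v∈L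

    in-no-K⇒∈S : ∀ {v} → ¬ (∃ λ i → v ∈ K i) → v ∈ S
    in-no-K⇒∈S {v} v∉K = decidable-stable (v ∈? S) (v∉K ∘ in-some-K)

    attached : ∀ i {u w} → u ∈ K i → w ∈ S → Adj G u w → proj₁ (colouring i) u ≡ true
    attached i u∈Ki w∈S adj = proj₂ (proj₂ (colouring i)) _ _ u∈Ki (λ w∈Ki → ∈component⇒∉S (K-component i) w∈Ki w∈S) adj

    proper-within : ∀ {i j u w} → u ∈ K i → w ∈ K j → Adj G u w → proj₁ (colouring i) u ≢ proj₁ (colouring j) w
    proper-within {i} {j} u∈Ki w∈Kj adj
      with refl ← K-injective j i (component-≡ (K-component j) (K-component i) w∈Kj
                    (adj-component (K-component i) u∈Ki (∈component⇒∉S (K-component j) w∈Kj) adj)) =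
      proj₁ (proj₂ (colouring i)) _ _ u∈Ki w∈Kj adj

    proper : ∀ u w → u ∈ ⊤ → w ∈ ⊤ → Adj G u w → colour u ≢ colour w
    proper u w _ _ adj with any? (λ i → u ∈? K i) | any? (λ i → w ∈? K i)
    ... | yes (i , u∈Ki) | yes (j , w∈Kj) = proper-within u∈Ki w∈Kj adj
    ... | yes (i , u∈Ki) | no  w∉K = λ cu≡false → true≢false (trans (sym (attached i u∈Ki (in-no-K⇒∈S w∉K) adj)) cu≡false)
    ... | no  u∉K | yes (j , w∈Kj) = λ false≡cw → true≢false (trans (sym (attached j w∈Kj (in-no-K⇒∈S u∉K) (adj-sym adj))) (sym false≡cw))
    ... | no  u∉K | no  w∉K = ⊥-elim (<⇒≢ (adj⇒0<edges (in-no-K⇒∈S u∉K) (in-no-K⇒∈S w∉K) adj) (sym S-independent))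

  nonbipartite-component : ¬ Bipartite G → ∃ λ L → Component L × 2 ≤ ∣ L ∣ × ¬ BipartiteOn G L
  nonbipartite-component nonbipartite with any? (λ i → (2 ≤? ∣ K i ∣) ×-dec ¬? (bipartiteOn? (K i)))
  ... | yes (i , 2≤ , nonbipartite-i) = K i , K-component i , 2≤ , nonbipartite-i
  ... | no  none = ⊥-elim (nonbipartite (Colouring.colour colouring , Colouring.proper colouring))
    where
      colouring : ∀ i → AttachedColouring (K i)
      colouring i = component-colouring i λ counterexample → none (i , counterexample)

lemma2p11 : ∀ {n : ℕ} (G : MGraph n) → V G ≡ ⊤ → Simple G → Cubic G → KConnected 3 G →
    (S : Subset n) → Barrier G S → 2 ≤ ∣ S ∣ →
    ((∀ K → IsComponent G S K → 2 ≤ ∣ K ∣ →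
        cutSize G K ≡ 3 × Tight G K × CutIsMatching G K) ×
     (∀ K → IsComponent G S K → 2 ≤ ∣ K ∣ →
        ThreeConnectedSimpleCubic (G / K) × ThreeConnectedSimpleCubic (G / (V G ─ K))) ×
     (¬ Bipartite G → ∃ λ K → IsComponent G S K × 2 ≤ ∣ K ∣ × ¬ BipartiteOn G K))
lemma2p11 (mgraph .⊤ m) refl ((msym , mloop , _) , m≤1) cubic (_ , conn) S (_ , K , K-odd-component , K-injective , _) 2≤∣S∣ =
  (λ L cL 2≤∣L∣ → component-cut≡3 cL , component-tight cL , component-matching cL 2≤∣L∣) ,
  (λ L cL 2≤∣L∣ → component-contractions cL 2≤∣L∣) ,
  nonbipartite-component
  where
    open Barrier m msym mloop m≤1 (λ v → cubic v ∈⊤) (λ X → conn X (λ _ → ∈⊤)) S K K-odd-component K-injective 2≤∣S∣
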